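{- Let $d$ be a positive integer and let $G_d$ be a graph obtained from a $d$-dock by making every $d$-bay of the dock full (by adding $d$-pods). Then $G_d$ has minimum degree $d-1$ and $G_d$ has no immersion of $K_d$.
   Context: Graphs are finite. A graph $H$ is immersed in a (multi)graph $G$ if there is an injection $\phi:V(H)\to V(G)$ and an assignment to each edge $uv\in E(H)$ of a path in $G$ between $\phi(u)$ and $\phi(v)$ such that paths of distinct edges are pairwise edge-disjoint. Fix a positive integer $d$. A $d$-pod is a simple graph in which every vertex has degree at least $d-2$ and at most $d-2$ vertices have degree exactly $d-2$, and which has the following property: letting $A$ be its set of vertices of degree exactly $d-2$, for every choice of a maximum matching on $A$ (i.e. $\lfloor |A|/2\rfloor$ pairwise disjoint pairs of vertices of $A$), the multigraph obtained by adding one new edge joining the two vertices of each chosen pair (parallel edges allowed) has no immersion of $K_d$. A $d$-bay is a graph with at most $d-2$ vertices. A $d$-dock is a graph consisting of one or more vertex-disjoint $d$-bays $B_1,\dots,B_n$ arranged in a circle, together with edges between bays, such that there are no edges between nonconsecutive bays and there are at most $d-3$ edges between any two consecutive bays $B_i,B_{i+1}$ (indices mod $n$; so when $n=2$ there may be up to $2(d-3)$ edges between the two bays, and when $n=1$ the dock is a single bay). A $d$-pod $Q$ is added to a $d$-bay $B$ by taking a copy of $Q$ disjoint from the rest of the graph and adding, for each vertex of $Q$ of degree $d-2$, one edge from that vertex to some vertex of $B$. A bay of the dock is full if $d$-pods are added to it (each pod being added to exactly one bay, with no edges between distinct pods) so that every vertex of the bay has degree at least $d-1$ in the resulting graph.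 -}

module Defs where

open import Data.Nat as ℕ using (ℕ; zero; suc; _+_; _*_; _≤_; _/_; _%_)
open import Data.Fin as Fin using (Fin; toℕ)
open import Data.Fin.Properties using () renaming (_≟_ to _≟ᶠ_)
open import Data.Bool using (Bool; true; false; _∧_; _∨_; not; T; if_then_else_)
open import Data.List using (List; []; _∷_; length; lookup; filterᵇ; allFin; foldr; _++_)
open import Data.List.Membership.Propositional using (_∈_)
open import Data.List.Relation.Unary.All using (All)
open import Data.List.Relation.Unary.AllPairs using (AllPairs)
open import Data.List.Relation.Unary.Unique.Propositional using (Unique)
open import Data.Product using (Σ; ∃; _×_; _,_; proj₁; proj₂)
open import Data.Sum using (_⊎_; inj₁; inj₂)
open import Relation.Nullary using (¬_)
open import Data.Empty using (⊥)
open import Relation.Nullary.Decidable using (⌊_⌋)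
open import Relation.Binary.PropositionalEquality using (_≡_; _≢_)
open import Function using (_⇔_)
open import Function.Definitions using (Injective)

-- Distinct list entries are distinct edges (so parallel edges are allowed
-- in a multigraph); a simple graph is one with no loops and no two
-- entries joining the same unordered pair.

Edges : ℕ → Set
Edges N = List (Fin N × Fin N)

_==ᶠ_ : ∀ {N} → Fin N → Fin N → Bool
x ==ᶠ y = ⌊ x ≟ᶠ y ⌋

_==ℕ_ : ℕ → ℕ → Bool
x ==ℕ y = ⌊ x ℕ.≟ y ⌋

count : ∀ {A : Set} → (A → Bool) → List A → ℕ
count p xs = length (filterᵇ p xs)

countV : ∀ {N} → (Fin N → Bool) → ℕ
countV {N} p = count p (allFin N)

deg : ∀ {N} → Edges N → Fin N → ℕ
deg E v = count (λ e → proj₁ e ==ᶠ v) E + count (λ e → proj₂ e ==ᶠ v) E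

joinsᵇ : ∀ {N} → Fin N × Fin N → Fin N → Fin N → Bool
joinsᵇ (a , b) u v = (a ==ᶠ u ∧ b ==ᶠ v) ∨ (a ==ᶠ v ∧ b ==ᶠ u)

adjᵇ : ∀ {N} → Edges N → Fin N → Fin N → Bool
adjᵇ E u v = foldr (λ e r → joinsᵇ e u v ∨ r) false E

Adj : ∀ {N} → Edges N → Fin N → Fin N → Set
Adj E u v = T (adjᵇ E u v)

SameEdge : ∀ {N} → Fin N × Fin N → Fin N × Fin N → Set
SameEdge (a , b) (c , d) = (a ≡ c × b ≡ d) ⊎ (a ≡ d × b ≡ c)

record IsSimple {N : ℕ} (E : Edges N) : Set where
  field
    noLoops    : All (λ e → proj₁ e ≢ proj₂ e) E
    noParallel : AllPairs (λ e e′ → ¬ SameEdge e e′) E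

-- Walks / paths in a multigraph; edges are identified by their index in
-- the edge list, so parallel edges are distinct.

Joins : ∀ {N} → Fin N × Fin N → Fin N → Fin N → Set
Joins (a , b) u w = (a ≡ u × b ≡ w) ⊎ (a ≡ w × b ≡ u)

data Walk {N : ℕ} (E : Edges N) : Fin N → Fin N → Set where
  []   : ∀ {u} → Walk E u u
  step : ∀ {u w v} (e : Fin (length E)) → Joins (lookup E e) u w →
         Walk E w v → Walk E u v

walkVerts : ∀ {N} {E : Edges N} {u v} → Walk E u v → List (Fin N)
walkVerts {u = u} []            = u ∷ []
walkVerts {u = u} (step e _ w)  = u ∷ walkVerts w

walkEdges : ∀ {N} {E : Edges N} {u v} → Walk E u v → List (Fin (length E))
walkEdges []           = []
walkEdges (step e _ w) = e ∷ walkEdges w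

IsPath : ∀ {N} {E : Edges N} {u v} → Walk E u v → Set
IsPath w = Unique (walkVerts w)

record ImmersionK {N : ℕ} (d : ℕ) (E : Edges N) : Set where
  field
    φ        : Fin d → Fin N
    φ-inj    : Injective _≡_ _≡_ φ
    route    : (i j : Fin d) → i Fin.< j → Walk E (φ i) (φ j)
    isPath   : ∀ i j (p : i Fin.< j) → IsPath (route i j p)
    disjoint : ∀ i j (p : i Fin.< j) i′ j′ (p′ : i′ Fin.< j′) →
               (i ≢ i′ ⊎ j ≢ j′) →
               ∀ e → e ∈ walkEdges (route i j p) →
                     e ∈ walkEdges (route i′ j′ p′) → ⊥

module _ (d : ℕ) {k : ℕ} (P : Edges k) where

  -- x has degree exactly d - 2 (written so that it is impossible for d < 2)
  InA : Fin k → Set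
  InA x = deg P x + 2 ≡ d

  inAᵇ : Fin k → Bool
  inAᵇ x = (deg P x + 2) ==ℕ d

  sizeA : ℕ
  sizeA = countV inAᵇ

  pairVerts : Edges k → List (Fin k)
  pairVerts []            = []
  pairVerts ((a , b) ∷ M) = a ∷ b ∷ pairVerts M

  record IsMaxMatchingOnA (M : Edges k) : Set where
    field
      inA      : All (λ e → InA (proj₁ e) × InA (proj₂ e)) M
      disjoint : Unique (pairVerts M)
      size     : length M ≡ sizeA / 2

  record IsPod : Set where
    field
      simple   : IsSimple P
      minDeg   : ∀ x → d ≤ deg P x + 2
      fewA     : sizeA + 2 ≤ d
      noImmers : ∀ M → IsMaxMatchingOnA M → ¬ ImmersionK d (P ++ M)

-- Vertex v lies in bay i (place v ≡ inj₁ i) or in pod p (place v ≡ inj₂ p).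
-- Bays are B_0,…,B_{n-1} arranged cyclically (n = suc n₀ ≥ 1).

inBayᵇ : ∀ {n m} → Fin n ⊎ Fin m → Fin n → Bool
inBayᵇ (inj₁ i′) i = i′ ==ᶠ i
inBayᵇ (inj₂ _)  _ = false

inPodᵇ : ∀ {n m} → Fin n ⊎ Fin m → Fin m → Bool
inPodᵇ (inj₁ _)  _ = false
inPodᵇ (inj₂ p′) p = p′ ==ᶠ p

-- number of k with {B_k, B_{k+1 mod n}} = {B_i, B_j} (as an ordered
-- occurrence): 0 if i, j nonconsecutive, 1 if consecutive and n ≥ 3,
-- 2 if n = 2 and i ≢ j
consecutive : ∀ {n₀} → Fin (suc n₀) → Fin (suc n₀) → ℕ
consecutive {n₀} i j =
  countV (λ k → (k ==ᶠ i ∧ (toℕ j ==ℕ (suc (toℕ k) % suc n₀)))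
              ∨ (k ==ᶠ j ∧ (toℕ i ==ℕ (suc (toℕ k) % suc n₀))))

record FullDockGraph (d N : ℕ) (E : Edges N) : Set where
  field
    n₀      : ℕ
    m       : ℕ
    place   : Fin N → Fin (suc n₀) ⊎ Fin m
    host    : Fin m → Fin (suc n₀)    -- bay to which pod p is added
    podSize : Fin m → ℕ
    podE    : (p : Fin m) → Edges (podSize p)
    pod     : ∀ p → IsPod d (podE p)
    emb     : (p : Fin m) → Fin (podSize p) → Fin N
    emb-inj   : ∀ p → Injective _≡_ _≡_ (emb p)
    emb-place : ∀ p x → place (emb p x) ≡ inj₂ p
    emb-onto  : ∀ v p → place v ≡ inj₂ p → ∃ λ x → emb p x ≡ v
    baySize   : ∀ i → countV (λ v → inBayᵇ (place v) i) + 2 ≤ d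
    -- edges between distinct bays i, j: at most (d-3)·(consecutive i j)
    -- (written without truncated subtraction)
    betweenBays : ∀ i j → i ≢ j →
      count (λ e → (inBayᵇ (place (proj₁ e)) i ∧ inBayᵇ (place (proj₂ e)) j)
                 ∨ (inBayᵇ (place (proj₁ e)) j ∧ inBayᵇ (place (proj₂ e)) i)) E
        + 3 * consecutive i j ≤ d * consecutive i j
    podInternal : ∀ p x y → Adj E (emb p x) (emb p y) ⇔ Adj (podE p) x y
    podExternal : ∀ p x v → place v ≢ inj₂ p → Adj E (emb p x) v →
                  place v ≡ inj₁ (host p)
    podAttach : ∀ p x →
      countV (λ v → adjᵇ E (emb p x) v ∧ not (inPodᵇ (place v) p))
        ≡ (if inAᵇ d (podE p) x then 1 else 0)
    full : ∀ v i → place v ≡ inj₁ i → d ≤ deg E v + 1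

module Submission where

-- The degree bound is local: bay vertices
-- are covered by fullness, pod vertices by the pod's minimum degree d - 2 plus the
-- extra edge each vertex of degree exactly d - 2 (the set A) sends to its bay.
-- Against an immersion we use the cut lemma: a vertex set holding s branch
-- vertices and missing t is crossed by at least s·t edges.  A pod is left by only
-- |A| ≤ d - 2 edges, so it holds no branch vertex or all of them; all of them is
-- impossible, since contracting every route onto the pod (each excursion from
-- a ∈ A back to b ∈ A becomes a new edge ab) immerses K_d in the pod plus a
-- maximum matching on A.  So the branch vertices lie in bays, and a suitable arc
-- of bays (a crowded bay, or the shortest initial arc holding two branch vertices)
-- would need at least 2d - 4 leaving edges while any arc is left by at most 2(d - 3).

open import Defs
open import Data.Nat as ℕ using (ℕ; zero; suc; _+_; _*_; _≤_; _<_; z≤n; s≤s; _/_; _%_; _<ᵇ_)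
open import Data.Nat.Properties
open import Data.Nat.DivMod using (m/n≡1+[m∸n]/n; n%n≡0; m<n⇒m%n≡m; m%n<n)
open import Data.Nat.Tactic.RingSolver using (solve-∀)
open import Data.Fin as Fin using (Fin; toℕ; fromℕ<)
open import Data.Fin.Properties using () renaming (_≟_ to _≟ᶠ_)
import Data.Fin.Properties as FinP
open import Data.Bool using (Bool; true; false; _∧_; _∨_; not; T; if_then_else_; _xor_)
open import Data.Bool.Properties using (T-∧; T-∨; T-≡)
open import Data.Unit using (tt)
open import Data.List using (List; []; _∷_; length; lookup; filterᵇ; allFin; _++_; map; concat; tabulate; cartesianProduct)
open import Data.List.Properties using (length-++; length-tabulate; tabulate-lookup; map-tabulate)
open import Data.List.Membership.Propositional using (_∈_)
open import Data.List.Membership.Propositional.Properties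
  using (∈-lookup; ∈-allFin; ∈-filter⁺; ∈-filter⁻; ∈-++⁻; ∈-++⁺ˡ; ∈-++⁺ʳ; ∈-cartesianProduct⁺)
open import Data.List.Relation.Unary.Any using (here; there)
import Data.List.Relation.Unary.Any as Any
open import Data.List.Relation.Unary.Any.Properties using (lookup-index)
open import Data.List.Relation.Unary.All as All using (All; []; _∷_)
import Data.List.Relation.Unary.All.Properties as AllP
open import Data.List.Relation.Unary.AllPairs as AllPairs using (AllPairs; []; _∷_)
open import Data.List.Relation.Unary.Unique.Propositional using (Unique)
import Data.List.Relation.Unary.Unique.Propositional.Properties as UniqueP
open import Data.List.Relation.Binary.Sublist.Propositional using (_⊆_; []; _∷_; _∷ʳ_)
open import Data.List.Relation.Binary.Sublist.Propositional.Properties using (Any-resp-⊆)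
open import Data.Product using (Σ; _×_; _,_; proj₁; proj₂)
open import Data.Sum using (_⊎_; inj₁; inj₂; [_,_]′)
import Data.Sum as Sum
import Data.Sum.Properties as SumP
open import Data.Empty using (⊥; ⊥-elim)
open import Relation.Nullary using (¬_; yes; no; Dec)
open import Relation.Nullary.Decidable using (⌊_⌋; T?; toWitness; fromWitness)
open import Relation.Binary using (DecidableEquality; tri<; tri≈; tri>)
open import Relation.Binary.PropositionalEquality
open import Function using (_∘_)
open import Function.Bundles using (Equivalence)

∧-intro : ∀ {a b} → T a → T b → T (a ∧ b)
∧-intro {a} {b} ta tb = Equivalence.from (T-∧ {a} {b}) (ta , tb)

∧-proj₁ : ∀ {a b} → T (a ∧ b) → T a
∧-proj₁ {a} {b} = proj₁ ∘ Equivalence.to (T-∧ {a} {b})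

∧-proj₂ : ∀ {a b} → T (a ∧ b) → T b
∧-proj₂ {a} {b} = proj₂ ∘ Equivalence.to (T-∧ {a} {b})

∨-inj₁ : ∀ {a b} → T a → T (a ∨ b)
∨-inj₁ {a} {b} = Equivalence.from (T-∨ {a} {b}) ∘ inj₁

∨-inj₂ : ∀ {a b} → T b → T (a ∨ b)
∨-inj₂ {a} {b} = Equivalence.from (T-∨ {a} {b}) ∘ inj₂

∨-cases : ∀ {a b} → T (a ∨ b) → T a ⊎ T b
∨-cases {a} {b} = Equivalence.to (T-∨ {a} {b})

T-not : ∀ {b} → ¬ T b → T (not b)
T-not {false} _ = tt
T-not {true} f = f tt

not-T : ∀ {b} → T (not b) → ¬ T b
not-T {false} _ ()

T-stable : ∀ {b} → ¬ T (not b) → T b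
T-stable {true} _ = tt
T-stable {false} f = f tt

T-ext : ∀ {a b : Bool} → (T a → T b) → (T b → T a) → a ≡ b
T-ext {true} {true} _ _ = refl
T-ext {false} {false} _ _ = refl
T-ext {true} {false} f _ = ⊥-elim (f tt)
T-ext {false} {true} _ g = ⊥-elim (g tt)

≡true⇒T : ∀ {b} → b ≡ true → T b
≡true⇒T = Equivalence.from T-≡

T⇒≡true : ∀ {b} → T b → b ≡ true
T⇒≡true = Equivalence.to T-≡

==ᶠ-sound : ∀ {N} {x y : Fin N} → T (x ==ᶠ y) → x ≡ y
==ᶠ-sound = toWitness

==ᶠ-complete : ∀ {N} {x y : Fin N} → x ≡ y → T (x ==ᶠ y)
==ᶠ-complete = fromWitness

==ℕ-sound : ∀ {x y} → T (x ==ℕ y) → x ≡ y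
==ℕ-sound = toWitness

==ℕ-complete : ∀ {x y} → x ≡ y → T (x ==ℕ y)
==ℕ-complete = fromWitness

xor-self : ∀ b → ¬ T (b xor b)
xor-self true  ()
xor-self false ()

xor-sym : ∀ a b → T (a xor b) → T (b xor a)
xor-sym true  false t = t
xor-sym false true  t = t

module _ {A : Set} where

  count-mono : (p q : A → Bool) (xs : List A) → (∀ {x} → x ∈ xs → T (p x) → T (q x)) →
               count p xs ≤ count q xs
  count-mono p q [] h = z≤n
  count-mono p q (x ∷ xs) h with p x in eq | q x in eq′
  ... | true  | true  = s≤s (count-mono p q xs (λ m → h (there m)))
  ... | true  | false = ⊥-elim (subst T eq′ (h (here refl) (≡true⇒T eq)))
  ... | false | true  = m≤n⇒m≤1+n (count-mono p q xs (λ m → h (there m)))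
  ... | false | false = count-mono p q xs (λ m → h (there m))

  count-∨ : (p q : A → Bool) (xs : List A) →
            count (λ x → p x ∨ q x) xs ≤ count p xs + count q xs
  count-∨ p q [] = z≤n
  count-∨ p q (x ∷ xs) with p x | q x
  ... | true  | true  = s≤s (≤-trans (count-∨ p q xs) (≤-trans (n≤1+n _) (≤-reflexive (sym (+-suc _ _)))))
  ... | true  | false = s≤s (count-∨ p q xs)
  ... | false | true  = ≤-trans (s≤s (count-∨ p q xs)) (≤-reflexive (sym (+-suc _ _)))
  ... | false | false = count-∨ p q xs

  count-split : (p q : A → Bool) (xs : List A) →
                count p xs ≡ count (λ x → p x ∧ q x) xs + count (λ x → p x ∧ not (q x)) xs
  count-split p q [] = refl
  count-split p q (x ∷ xs) with p x | q x
  ... | true  | true  = cong suc (count-split p q xs)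
  ... | true  | false = trans (cong suc (count-split p q xs)) (sym (+-suc _ _))
  ... | false | _     = count-split p q xs

  count-compl : (p : A → Bool) (xs : List A) → count p xs + count (λ x → not (p x)) xs ≡ length xs
  count-compl p [] = refl
  count-compl p (x ∷ xs) with p x
  ... | true  = cong suc (count-compl p xs)
  ... | false = trans (+-suc _ _) (cong suc (count-compl p xs))

  count-++ : (p : A → Bool) (xs ys : List A) → count p (xs ++ ys) ≡ count p xs + count p ys
  count-++ p [] ys = refl
  count-++ p (x ∷ xs) ys with p x
  ... | true  = cong suc (count-++ p xs ys)
  ... | false = count-++ p xs ys

  count-ext : (p q : A → Bool) (xs : List A) → (∀ x → p x ≡ q x) → count p xs ≡ count q xs
  count-ext p q [] h = refl
  count-ext p q (x ∷ xs) h with p x | q x | h x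
  ... | true  | true  | _ = cong suc (count-ext p q xs h)
  ... | false | false | _ = count-ext p q xs h

  count-witness : (p : A → Bool) (xs : List A) → 1 ≤ count p xs → Σ A λ x → x ∈ xs × T (p x)
  count-witness p (y ∷ xs) c with p y in eq
  ... | true  = y , here refl , ≡true⇒T eq
  ... | false = let (x , m , t) = count-witness p xs c in x , there m , t

  count-pos : (p : A → Bool) {x : A} (xs : List A) → x ∈ xs → T (p x) → 1 ≤ count p xs
  count-pos p (y ∷ xs) m t with p y in eq
  ... | true  = s≤s z≤n
  count-pos p (y ∷ xs) (here refl) t | false = ⊥-elim (subst T eq t)
  count-pos p (y ∷ xs) (there m)   t | false = count-pos p xs m t

  count-none : (p : A → Bool) {x : A} (xs : List A) → count p xs ≡ 0 → x ∈ xs → ¬ T (p x)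
  count-none p xs c m t with count-pos p xs m t
  ... | pos rewrite c with pos
  ... | ()

  count-zero : (p : A → Bool) (xs : List A) → (∀ {x} → x ∈ xs → ¬ T (p x)) → count p xs ≡ 0
  count-zero p [] h = refl
  count-zero p (x ∷ xs) h with p x in eq
  ... | true  = ⊥-elim (h (here refl) (≡true⇒T eq))
  ... | false = count-zero p xs (λ m → h (there m))

  count-full : (p : A → Bool) (xs : List A) → (∀ {x} → x ∈ xs → T (p x)) → count p xs ≡ length xs
  count-full p [] h = refl
  count-full p (x ∷ xs) h with p x in eq
  ... | true  = cong suc (count-full p xs (λ m → h (there m)))
  ... | false = ⊥-elim (subst T eq (h (here refl)))

  count≤1 : (p : A → Bool) (xs : List A) → Unique xs →
            (∀ {a b} → a ∈ xs → b ∈ xs → T (p a) → T (p b) → a ≡ b) → count p xs ≤ 1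
  count≤1 p [] u h = z≤n
  count≤1 p (y ∷ xs) (y∉ ∷ u) h with p y in eq
  ... | false = count≤1 p xs u (λ a b → h (there a) (there b))
  ... | true  = s≤s (≤-reflexive (count-zero p xs
                  (λ m t → All.lookup y∉ m (h (here refl) (there m) (≡true⇒T eq) t))))

-- A list counted through its positions (walks name the edges of a multigraph by
-- their positions in the edge list).
count-positions : {A : Set} (p : A → Bool) (xs : List A) →
                  count (p ∘ lookup xs) (allFin (length xs)) ≡ count p xs
count-positions p xs = begin
    count (p ∘ lookup xs) (tabulate (λ i → i))   ≡⟨ count-map p (lookup xs) (tabulate (λ i → i)) ⟨
    count p (map (lookup xs) (tabulate (λ i → i))) ≡⟨ cong (count p) (map-tabulate (λ i → i) (lookup xs)) ⟩
    count p (tabulate (lookup xs))                ≡⟨ cong (count p) (tabulate-lookup xs) ⟩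
    count p xs                                    ∎
  where
    open ≡-Reasoning
    count-map : {A B : Set} (p : A → Bool) (f : B → A) (ys : List B) → count p (map f ys) ≡ count (p ∘ f) ys
    count-map p f [] = refl
    count-map p f (y ∷ ys) with p (f y)
    ... | true  = cong suc (count-map p f ys)
    ... | false = count-map p f ys

count-self≤1 : ∀ {n} (i : Fin n) → count (λ k → k ==ᶠ i) (allFin n) ≤ 1
count-self≤1 {n} i = count≤1 _ (allFin n) (UniqueP.allFin⁺ n) (λ _ _ ta tb → trans (==ᶠ-sound ta) (sym (==ᶠ-sound tb)))

module _ {A : Set} where

  remove : {y : A} (zs : List A) → y ∈ zs → List A
  remove (z ∷ zs) (here _)  = zs
  remove (z ∷ zs) (there m) = z ∷ remove zs m

  length-remove : {y : A} (zs : List A) (m : y ∈ zs) → suc (length (remove zs m)) ≡ length zs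
  length-remove (z ∷ zs) (here _)  = refl
  length-remove (z ∷ zs) (there m) = cong suc (length-remove zs m)

  ∈-remove : {y z : A} (zs : List A) (m : y ∈ zs) → z ∈ zs → z ≢ y → z ∈ remove zs m
  ∈-remove (w ∷ zs) (here refl) (here refl) z≢y = ⊥-elim (z≢y refl)
  ∈-remove (w ∷ zs) (here _)    (there q)   z≢y = q
  ∈-remove (w ∷ zs) (there m)   (here q)    z≢y = here q
  ∈-remove (w ∷ zs) (there m)   (there q)   z≢y = there (∈-remove zs m q z≢y)

module _ {A B : Set} where

  injection-length-≤ : (ys : List A) (zs : List B) (f : ∀ {y} → y ∈ ys → B) → Unique ys →
                       (∀ {a b} (ma : a ∈ ys) (mb : b ∈ ys) → f ma ≡ f mb → a ≡ b) →
                       (∀ {y} (m : y ∈ ys) → f m ∈ zs) → length ys ≤ length zs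
  injection-length-≤ [] zs f u inj into = z≤n
  injection-length-≤ (y ∷ ys) zs f (y∉ ∷ u) inj into = begin
      suc (length ys)                  ≤⟨ s≤s rest ⟩
      suc (length (remove zs fy∈zs))   ≡⟨ length-remove zs fy∈zs ⟩
      length zs                        ∎
    where
      open ≤-Reasoning
      fy∈zs = into (here refl)
      rest : length ys ≤ length (remove zs fy∈zs)
      rest = injection-length-≤ ys (remove zs fy∈zs) (λ m → f (there m)) u
               (λ a b e → inj (there a) (there b) e)
               (λ m → ∈-remove zs fy∈zs (into (there m))
                        (λ e → All.lookup y∉ m (sym (inj (there m) (here refl) e))))

module _ {A : Set} where

  ⊆-length-≤ : (ys zs : List A) → Unique ys → (∀ {y} → y ∈ ys → y ∈ zs) → length ys ≤ length zs
  ⊆-length-≤ ys zs u sub = injection-length-≤ ys zs (λ {y} _ → y) u (λ _ _ e → e) sub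

  count≤1-unique : DecidableEquality A → (p : A → Bool) (xs : List A) → Unique xs →
                   ∀ {a b} → a ∈ xs → b ∈ xs → T (p a) → T (p b) → count p xs ≤ 1 → a ≡ b
  count≤1-unique _≟_ p xs u {a} {b} ma mb ta tb c with a ≟ b
  ... | yes a≡b = a≡b
  ... | no a≢b = ⊥-elim (<-irrefl refl (≤-trans two≤count c))
    where
      two≤count : 2 ≤ count p xs
      two≤count = ⊆-length-≤ (a ∷ b ∷ []) (filterᵇ p xs) ((a≢b ∷ []) ∷ [] ∷ [])
        (λ { (here refl) → ∈-filter⁺ (T? ∘ p) ma ta ; (there (here refl)) → ∈-filter⁺ (T? ∘ p) mb tb })

  lookup-injective : (S : A → A → Set) → (∀ {a b} → S a b → S b a) →
                     (xs : List A) → AllPairs (λ a b → ¬ S a b) xs → (i j : Fin (length xs)) →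
                     S (lookup xs i) (lookup xs j) → i ≡ j
  lookup-injective S sym-S (x ∷ xs) (x∉ ∷ u) Fin.zero    Fin.zero    s = refl
  lookup-injective S sym-S (x ∷ xs) (x∉ ∷ u) Fin.zero    (Fin.suc j) s = ⊥-elim (All.lookup x∉ (∈-lookup j) s)
  lookup-injective S sym-S (x ∷ xs) (x∉ ∷ u) (Fin.suc i) Fin.zero    s = ⊥-elim (All.lookup x∉ (∈-lookup i) (sym-S s))
  lookup-injective S sym-S (x ∷ xs) (x∉ ∷ u) (Fin.suc i) (Fin.suc j) s = cong Fin.suc (lookup-injective S sym-S xs u i j s)

module _ {A B : Set} where

  count-pairs-row : (p : A → Bool) (q : B → Bool) (x : A) (ys : List B) →
    count (λ ij → p (proj₁ ij) ∧ q (proj₂ ij)) (map (x ,_) ys) ≡ (if p x then count q ys else 0)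
  count-pairs-row p q x [] with p x
  ... | true  = refl
  ... | false = refl
  count-pairs-row p q x (y ∷ ys) with p x in px | q y
  ... | true  | true  = cong suc (trans (count-pairs-row p q x ys) (cong (λ b → if b then count q ys else 0) px))
  ... | true  | false = trans (count-pairs-row p q x ys) (cong (λ b → if b then count q ys else 0) px)
  ... | false | _     = trans (count-pairs-row p q x ys) (cong (λ b → if b then count q ys else 0) px)

  count-pairs : (p : A → Bool) (q : B → Bool) (xs : List A) (ys : List B) →
    count (λ ij → p (proj₁ ij) ∧ q (proj₂ ij)) (cartesianProduct xs ys) ≡ count p xs * count q ys
  count-pairs p q [] ys = refl
  count-pairs p q (x ∷ xs) ys = begin
      count r (map (x ,_) ys ++ cartesianProduct xs ys)
        ≡⟨ count-++ r (map (x ,_) ys) (cartesianProduct xs ys) ⟩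
      count r (map (x ,_) ys) + count r (cartesianProduct xs ys)
        ≡⟨ cong₂ _+_ (count-pairs-row p q x ys) (count-pairs p q xs ys) ⟩
      (if p x then count q ys else 0) + count p xs * count q ys
        ≡⟨ row x ⟩
      count p (x ∷ xs) * count q ys ∎
    where
      open ≡-Reasoning
      r = λ ij → p (proj₁ ij) ∧ q (proj₂ ij)
      row : ∀ x → (if p x then count q ys else 0) + count p xs * count q ys ≡ count p (x ∷ xs) * count q ys
      row x with p x
      ... | true  = refl
      ... | false = refl

unique-⊆ : {A : Set} {xs ys : List A} → xs ⊆ ys → Unique ys → Unique xs
unique-⊆ [] u = u
unique-⊆ (y ∷ʳ τ) (_ ∷ u) = unique-⊆ τ u
unique-⊆ (refl ∷ τ) (y∉ ∷ u) = All.tabulate (λ m → All.lookup y∉ (Any-resp-⊆ τ m)) ∷ unique-⊆ τ u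

module _ {B : Set} where

  injˡ : (A C : List B) → Fin (length A) → Fin (length (A ++ C))
  injˡ (x ∷ A) C Fin.zero    = Fin.zero
  injˡ (x ∷ A) C (Fin.suc i) = Fin.suc (injˡ A C i)

  injʳ : (A C : List B) → Fin (length C) → Fin (length (A ++ C))
  injʳ []      C i = i
  injʳ (x ∷ A) C i = Fin.suc (injʳ A C i)

  lookup-injˡ : (A C : List B) (i : Fin (length A)) → lookup (A ++ C) (injˡ A C i) ≡ lookup A i
  lookup-injˡ (x ∷ A) C Fin.zero    = refl
  lookup-injˡ (x ∷ A) C (Fin.suc i) = lookup-injˡ A C i

  lookup-injʳ : (A C : List B) (i : Fin (length C)) → lookup (A ++ C) (injʳ A C i) ≡ lookup C i
  lookup-injʳ []      C i = refl
  lookup-injʳ (x ∷ A) C i = lookup-injʳ A C i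

  injˡ-injective : (A C : List B) {i j : Fin (length A)} → injˡ A C i ≡ injˡ A C j → i ≡ j
  injˡ-injective (x ∷ A) C {Fin.zero}  {Fin.zero}  e = refl
  injˡ-injective (x ∷ A) C {Fin.suc i} {Fin.suc j} e = cong Fin.suc (injˡ-injective A C (FinP.suc-injective e))

  injʳ-injective : (A C : List B) {i j : Fin (length C)} → injʳ A C i ≡ injʳ A C j → i ≡ j
  injʳ-injective []      C e = e
  injʳ-injective (x ∷ A) C e = injʳ-injective A C (FinP.suc-injective e)

  injˡ≢injʳ : (A C : List B) {i : Fin (length A)} {j : Fin (length C)} → injˡ A C i ≢ injʳ A C j
  injˡ≢injʳ (x ∷ A) C {Fin.zero}  ()
  injˡ≢injʳ (x ∷ A) C {Fin.suc i} e = injˡ≢injʳ A C (FinP.suc-injective e)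

  module Blocks {K : Set} (X : K → List B) where

    injBlock : (L : List K) {κ : K} → κ ∈ L → Fin (length (X κ)) → Fin (length (concat (map X L)))
    injBlock (κ₀ ∷ L) (here refl) z = injˡ (X κ₀) _ z
    injBlock (κ₀ ∷ L) (there m)   z = injʳ (X κ₀) _ (injBlock L m z)

    lookup-injBlock : (L : List K) {κ : K} (m : κ ∈ L) (z : Fin (length (X κ))) →
                      lookup (concat (map X L)) (injBlock L m z) ≡ lookup (X κ) z
    lookup-injBlock (κ₀ ∷ L) (here refl) z = lookup-injˡ (X κ₀) _ z
    lookup-injBlock (κ₀ ∷ L) (there m)   z = trans (lookup-injʳ (X κ₀) _ (injBlock L m z)) (lookup-injBlock L m z)

    injBlock-key : (L : List K) {κ κ′ : K} (m : κ ∈ L) (m′ : κ′ ∈ L)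
                   {z : Fin (length (X κ))} {z′ : Fin (length (X κ′))} →
                   injBlock L m z ≡ injBlock L m′ z′ → κ ≡ κ′
    injBlock-key (κ₀ ∷ L) (here refl) (here refl) e = refl
    injBlock-key (κ₀ ∷ L) (here refl) (there m′)  e = ⊥-elim (injˡ≢injʳ (X κ₀) _ e)
    injBlock-key (κ₀ ∷ L) (there m)   (here refl) e = ⊥-elim (injˡ≢injʳ (X κ₀) _ (sym e))
    injBlock-key (κ₀ ∷ L) (there m)   (there m′)  e = injBlock-key L m m′ (injʳ-injective (X κ₀) _ e)

module _ {A K : Set} (X : K → List A) where

  ∈-blocks⁻ : (L : List K) {a : A} → a ∈ concat (map X L) → Σ K λ κ → κ ∈ L × a ∈ X κ
  ∈-blocks⁻ (κ ∷ L) m with ∈-++⁻ (X κ) m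
  ... | inj₁ m′ = κ , here refl , m′
  ... | inj₂ m′ = let (κ′ , mκ , ma) = ∈-blocks⁻ L m′ in κ′ , there mκ , ma

  ∈-blocks⁺ : (L : List K) {a : A} {κ : K} → κ ∈ L → a ∈ X κ → a ∈ concat (map X L)
  ∈-blocks⁺ (κ ∷ L)  (here refl) ma = ∈-++⁺ˡ ma
  ∈-blocks⁺ (κ′ ∷ L) (there m)   ma = ∈-++⁺ʳ (X κ′) (∈-blocks⁺ L m ma)

  unique-blocks : (L : List K) → Unique L → (∀ {κ} → κ ∈ L → Unique (X κ)) →
                  (∀ {κ κ′ a} → κ ∈ L → κ′ ∈ L → κ ≢ κ′ → a ∈ X κ → a ∈ X κ′ → ⊥) →
                  Unique (concat (map X L))
  unique-blocks [] u uX disj = []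
  unique-blocks (κ ∷ L) (κ∉ ∷ u) uX disj =
    UniqueP.++⁺ (uX (here refl))
      (unique-blocks L u (λ m → uX (there m)) (λ m m′ → disj (there m) (there m′)))
      (λ (m₁ , m₂) → let (κ′ , mκ , ma) = ∈-blocks⁻ L m₂ in
                     disj (here refl) (there mκ) (All.lookup κ∉ mκ) m₁ ma)

half-suc-suc : ∀ n → suc (suc n) / 2 ≡ suc (n / 2)
half-suc-suc n = m/n≡1+[m∸n]/n {suc (suc n)} {2} (s≤s (s≤s z≤n))

half-double+ : ∀ a u → (a + a + u) / 2 ≡ a + u / 2
half-double+ zero    u = refl
half-double+ (suc a) u = begin
    (suc a + suc a + u) / 2    ≡⟨ cong (λ z → suc (z + u) / 2) (+-suc a a) ⟩
    suc (suc (a + a + u)) / 2  ≡⟨ half-suc-suc (a + a + u) ⟩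
    suc ((a + a + u) / 2)      ≡⟨ cong suc (half-double+ a u) ⟩
    suc a + u / 2              ∎
  where open ≡-Reasoning

module _ {A : Set} where

  pairUp : List A → List (A × A)
  pairUp (a ∷ b ∷ r) = (a , b) ∷ pairUp r
  pairUp _           = []

  length-pairUp : (xs : List A) → length (pairUp xs) ≡ length xs / 2
  length-pairUp []          = refl
  length-pairUp (a ∷ [])    = refl
  length-pairUp (a ∷ b ∷ r) = trans (cong suc (length-pairUp r)) (sym (half-suc-suc (length r)))

sum≤product+1 : ∀ s t → suc s + suc t ≤ suc s * suc t + 1
sum≤product+1 s t = begin
    suc s + suc t          ≤⟨ m≤m+n (suc s + suc t) (s * t) ⟩
    suc s + suc t + s * t  ≡⟨ expand s t ⟩
    suc s * suc t + 1      ∎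
  where
    open ≤-Reasoning
    expand : ∀ s t → suc s + suc t + s * t ≡ suc s * suc t + 1
    expand = solve-∀

if-≤1 : ∀ b → (if b then 1 else 0) ≤ 1
if-≤1 true  = s≤s z≤n
if-≤1 false = z≤n

between-bound₁ : ∀ d c x → x + 3 * c ≤ d * c → c ≤ 1 → 3 ≤ d → x + 3 ≤ d
between-bound₁ d zero x h _ 3≤d rewrite *-zeroʳ d | +-identityʳ x with h
... | z≤n = 3≤d
between-bound₁ d (suc zero) x h _ 3≤d rewrite *-identityʳ d = h
between-bound₁ d (suc (suc c)) x h (s≤s ()) 3≤d

between-bound₂ : ∀ d c x → x + 3 * c ≤ d * c → c ≤ 2 → 3 ≤ d → x + 6 ≤ d + d
between-bound₂ d zero x h _ 3≤d rewrite *-zeroʳ d | +-identityʳ x with h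
... | z≤n = +-mono-≤ 3≤d 3≤d
between-bound₂ d (suc zero) x h _ 3≤d rewrite *-identityʳ d =
  ≤-trans (≤-reflexive (sym (+-assoc x 3 3))) (+-mono-≤ h 3≤d)
between-bound₂ d (suc (suc zero)) x h _ 3≤d = ≤-trans h (≤-reflexive (trans (*-comm d 2) (cong (d +_) (+-identityʳ d))))
between-bound₂ d (suc (suc (suc c))) x h (s≤s (s≤s ())) 3≤d

double-sum≤product+4 : ∀ s t → 2 ≤ s → (2 ≤ t ⊎ s ≡ 2) → 2 * (s + t) ≤ s * t + 4
double-sum≤product+4 (suc (suc zero)) t _ (inj₂ _) = ≤-reflexive (double t)
  where double : ∀ t → 2 * (2 + t) ≡ 2 * t + 4
        double = solve-∀
double-sum≤product+4 (suc (suc a)) (suc (suc b)) _ (inj₁ _) = begin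
    2 * (suc (suc a) + suc (suc b))       ≡⟨ expand a b ⟩
    8 + 2 * a + 2 * b                     ≤⟨ m≤m+n _ (a * b) ⟩
    8 + 2 * a + 2 * b + a * b             ≡⟨ expand′ a b ⟩
    suc (suc a) * suc (suc b) + 4         ∎
  where
    open ≤-Reasoning
    expand : ∀ a b → 2 * (suc (suc a) + suc (suc b)) ≡ 8 + 2 * a + 2 * b
    expand = solve-∀
    expand′ : ∀ a b → 8 + 2 * a + 2 * b + a * b ≡ suc (suc a) * suc (suc b) + 4
    expand′ = solve-∀
double-sum≤product+4 (suc (suc a)) zero          _ (inj₁ ())
double-sum≤product+4 (suc (suc a)) (suc zero)    _ (inj₁ (s≤s ()))
double-sum≤product+4 (suc (suc (suc a))) t       _ (inj₂ ())
double-sum≤product+4 (suc zero)          t       (s≤s ()) _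

intermediate-value : (f : ℕ → ℕ) → f 0 ≡ 0 → ∀ n → (∀ K → K < n → f (suc K) ≤ suc (f K)) →
                     ∀ t → t ≤ f n → Σ ℕ λ K → K ≤ n × f K ≡ t
intermediate-value f f0 zero steps t t≤ = 0 , z≤n , trans f0 (sym (n≤0⇒n≡0 (≤-trans t≤ (≤-reflexive f0))))
intermediate-value f f0 (suc n) steps t t≤ with t ℕ.≤? f n
... | yes t≤fn = let (K , K≤n , fK) = intermediate-value f f0 n (λ K K<n → steps K (≤-trans K<n (n≤1+n n))) t t≤fn
                 in K , ≤-trans K≤n (n≤1+n n) , fK
... | no t≰fn = suc n , ≤-refl , ≤-antisym t≤′ t≤
  where t≤′ = ≤-trans (steps n ≤-refl) (≰⇒> t≰fn)

module _ {N : ℕ} where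

  joinsᵇ-complete : (e : Fin N × Fin N) {u v : Fin N} → Joins e u v → T (joinsᵇ e u v)
  joinsᵇ-complete (a , b) (inj₁ (refl , refl)) =
    ∨-inj₁ (∧-intro {a ==ᶠ a} (==ᶠ-complete {x = a} refl) (==ᶠ-complete {x = b} refl))
  joinsᵇ-complete (a , b) (inj₂ (refl , refl)) =
    ∨-inj₂ {a ==ᶠ b ∧ b ==ᶠ a} (∧-intro {a ==ᶠ a} (==ᶠ-complete {x = a} refl) (==ᶠ-complete {x = b} refl))

  joinsᵇ-sound : (e : Fin N × Fin N) (u v : Fin N) → T (joinsᵇ e u v) → Joins e u v
  joinsᵇ-sound (a , b) u v t with ∨-cases {a ==ᶠ u ∧ b ==ᶠ v} t
  ... | inj₁ t′ = inj₁ (==ᶠ-sound (∧-proj₁ t′) , ==ᶠ-sound (∧-proj₂ {a ==ᶠ u} t′))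
  ... | inj₂ t′ = inj₂ (==ᶠ-sound (∧-proj₁ t′) , ==ᶠ-sound (∧-proj₂ {a ==ᶠ v} t′))

  adj-intro : (E : Edges N) (e : Fin (length E)) {u v : Fin N} → Joins (lookup E e) u v → Adj E u v
  adj-intro (x ∷ E) Fin.zero    {u} {v} j = ∨-inj₁ (joinsᵇ-complete x j)
  adj-intro (x ∷ E) (Fin.suc e) {u} {v} j = ∨-inj₂ {joinsᵇ x u v} (adj-intro E e j)

  adj-elim : (E : Edges N) {u v : Fin N} → Adj E u v → Σ (Fin (length E)) λ e → Joins (lookup E e) u v
  adj-elim (x ∷ E) {u} {v} t with ∨-cases {joinsᵇ x u v} t
  ... | inj₁ t′ = Fin.zero , joinsᵇ-sound x u v t′
  ... | inj₂ t′ = let (e , j) = adj-elim E t′ in Fin.suc e , j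

  adj-∈ : (E : Edges N) {e : Fin N × Fin N} {u v : Fin N} → e ∈ E → Joins e u v → Adj E u v
  adj-∈ E m j = adj-intro E (Any.index m) (subst (λ z → Joins z _ _) (lookup-index m) j)

  joins-sym : {e : Fin N × Fin N} {u v : Fin N} → Joins e u v → Joins e v u
  joins-sym (inj₁ x) = inj₂ x
  joins-sym (inj₂ y) = inj₁ y

  joins-other-end : {e : Fin N × Fin N} {u₁ u₂ w v : Fin N} → Joins e u₁ u₂ → Joins e w v → v ≡ u₁ ⊎ v ≡ u₂
  joins-other-end (inj₁ (refl , refl)) (inj₁ (refl , refl)) = inj₂ refl
  joins-other-end (inj₁ (refl , refl)) (inj₂ (refl , refl)) = inj₁ refl
  joins-other-end (inj₂ (refl , refl)) (inj₁ (refl , refl)) = inj₁ refl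
  joins-other-end (inj₂ (refl , refl)) (inj₂ (refl , refl)) = inj₂ refl

  sameEdge-refl : {e : Fin N × Fin N} → SameEdge e e
  sameEdge-refl = inj₁ (refl , refl)

  sameEdge-sym : {e e′ : Fin N × Fin N} → SameEdge e e′ → SameEdge e′ e
  sameEdge-sym (inj₁ (refl , refl)) = inj₁ (refl , refl)
  sameEdge-sym (inj₂ (refl , refl)) = inj₂ (refl , refl)

  sameEdge-trans : {e e′ e″ : Fin N × Fin N} → SameEdge e e′ → SameEdge e′ e″ → SameEdge e e″
  sameEdge-trans (inj₁ (refl , refl)) (inj₁ (refl , refl)) = inj₁ (refl , refl)
  sameEdge-trans (inj₁ (refl , refl)) (inj₂ (refl , refl)) = inj₂ (refl , refl)
  sameEdge-trans (inj₂ (refl , refl)) (inj₁ (refl , refl)) = inj₂ (refl , refl)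
  sameEdge-trans (inj₂ (refl , refl)) (inj₂ (refl , refl)) = inj₁ (refl , refl)

  joins-same : {e e′ : Fin N × Fin N} {u v : Fin N} → Joins e u v → Joins e′ u v → SameEdge e e′
  joins-same (inj₁ (refl , refl)) (inj₁ (refl , refl)) = inj₁ (refl , refl)
  joins-same (inj₁ (refl , refl)) (inj₂ (refl , refl)) = inj₂ (refl , refl)
  joins-same (inj₂ (refl , refl)) (inj₁ (refl , refl)) = inj₂ (refl , refl)
  joins-same (inj₂ (refl , refl)) (inj₂ (refl , refl)) = inj₁ (refl , refl)

  simple-unique : (E : Edges N) → IsSimple E → Unique E
  simple-unique E s = AllPairs.map (λ ¬same e≡e′ → ¬same (subst (SameEdge _) e≡e′ sameEdge-refl)) (IsSimple.noParallel s)

  simple-position : (E : Edges N) → IsSimple E → (e e′ : Fin (length E)) →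
                    SameEdge (lookup E e) (lookup E e′) → e ≡ e′
  simple-position E s = lookup-injective SameEdge sameEdge-sym E (IsSimple.noParallel s)

  simple-entry : (E : Edges N) → IsSimple E → {x y : Fin N × Fin N} → x ∈ E → y ∈ E → SameEdge x y → x ≡ y
  simple-entry E s mx my same =
    trans (lookup-index mx)
      (trans (cong (lookup E) (simple-position E s (Any.index mx) (Any.index my)
                 (subst₂ SameEdge (lookup-index mx) (lookup-index my) same)))
             (sym (lookup-index my)))

  crossᵇ : (Fin N → Bool) → Fin N × Fin N → Bool
  crossᵇ S (a , b) = S a xor S b

  walk-crosses : {E : Edges N} (S : Fin N → Bool) {u v : Fin N} (w : Walk E u v) → T (S u xor S v) →
                 Σ (Fin (length E)) λ e → e ∈ walkEdges w × T (crossᵇ S (lookup E e))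
  walk-crosses S {u} [] t with S u
  ... | true  = ⊥-elim t
  ... | false = ⊥-elim t
  walk-crosses {E} S {u} {v} (step {w = w} e j rest) t with S u xor S w in first
  ... | true  = e , here refl , crosses j
    where
      crosses : Joins (lookup E e) u w → T (crossᵇ S (lookup E e))
      crosses (inj₁ (p , q)) rewrite p | q | first = tt
      crosses (inj₂ (p , q)) rewrite p | q = xor-sym (S u) (S w) (≡true⇒T first)
  ... | false = let (e′ , m , c) = walk-crosses S rest (same-side (S u) (S w) (S v) first t) in e′ , there m , c
    where
      same-side : ∀ a b c → a xor b ≡ false → T (a xor c) → T (b xor c)
      same-side true  true  c _ t = t
      same-side false false c _ t = t

-- The route joining a branch
-- vertex inside S to one outside uses an edge crossing S, and routes are
-- edge-disjoint, so at least s · t edges of E cross S.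

module CutLemma {d N : ℕ} (E : Edges N) (I : ImmersionK d E) (S : Fin N → Bool) where
  open ImmersionK I

  separated : Fin d × Fin d → Bool
  separated (i , j) = S (φ i) ∧ not (S (φ j))

  separated-xor : ∀ a b → T (a ∧ not b) → T (a xor b) × T (b xor a)
  separated-xor true false _ = tt , tt

  separated-irrefl : ∀ a → ¬ T (a ∧ not a)
  separated-irrefl true  ()
  separated-irrefl false ()

  record CrossingEdge (i j : Fin d) : Set where
    field
      a b     : Fin d
      a<b     : a Fin.< b
      edge    : Fin (length E)
      onRoute : edge ∈ walkEdges (route a b a<b)
      crosses : T (crossᵇ S (lookup E edge))
      ends    : (a ≡ i × b ≡ j) ⊎ (a ≡ j × b ≡ i)

  crossingEdge : ∀ i j → T (separated (i , j)) → CrossingEdge i j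
  crossingEdge i j sep with FinP.<-cmp i j | separated-xor (S (φ i)) (S (φ j)) sep
  ... | tri< i<j _ _ | ij , _ =
    let (e , m , c) = walk-crosses S (route i j i<j) ij
    in record { a = i ; b = j ; a<b = i<j ; edge = e ; onRoute = m ; crosses = c ; ends = inj₁ (refl , refl) }
  ... | tri≈ _ refl _ | _ = ⊥-elim (separated-irrefl (S (φ i)) sep)
  ... | tri> _ _ j<i | _ , ji =
    let (e , m , c) = walk-crosses S (route j i j<i) ji
    in record { a = j ; b = i ; a<b = j<i ; edge = e ; onRoute = m ; crosses = c ; ends = inj₂ (refl , refl) }

  same-route : ∀ {i j i′ j′} (c : CrossingEdge i j) (c′ : CrossingEdge i′ j′) →
               CrossingEdge.edge c ≡ CrossingEdge.edge c′ →
               CrossingEdge.a c ≡ CrossingEdge.a c′ × CrossingEdge.b c ≡ CrossingEdge.b c′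
  same-route c c′ e≡e′ with C.a ≟ᶠ C′.a | C.b ≟ᶠ C′.b
    where module C = CrossingEdge c
          module C′ = CrossingEdge c′
  ... | yes p | yes q = p , q
  ... | no a≢a′ | _ = ⊥-elim (disjoint _ _ (CrossingEdge.a<b c) _ _ (CrossingEdge.a<b c′) (inj₁ a≢a′)
                        (CrossingEdge.edge c) (CrossingEdge.onRoute c)
                        (subst (_∈ _) (sym e≡e′) (CrossingEdge.onRoute c′)))
  ... | yes _ | no b≢b′ = ⊥-elim (disjoint _ _ (CrossingEdge.a<b c) _ _ (CrossingEdge.a<b c′) (inj₂ b≢b′)
                        (CrossingEdge.edge c) (CrossingEdge.onRoute c)
                        (subst (_∈ _) (sym e≡e′) (CrossingEdge.onRoute c′)))

  crossingEdge-injective : ∀ {i j i′ j′} (c : CrossingEdge i j) (c′ : CrossingEdge i′ j′) →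
                           T (separated (i , j)) → T (separated (i′ , j′)) →
                           CrossingEdge.edge c ≡ CrossingEdge.edge c′ → (i , j) ≡ (i′ , j′)
  crossingEdge-injective {i} {j} {i′} {j′} c c′ sep sep′ e≡e′
    with same-route c c′ e≡e′ | CrossingEdge.ends c | CrossingEdge.ends c′
  ... | p , q | inj₁ (refl , refl) | inj₁ (refl , refl) = cong₂ _,_ p q
  ... | p , q | inj₂ (refl , refl) | inj₂ (refl , refl) = cong₂ _,_ q p
  ... | refl , refl | inj₁ (refl , refl) | inj₂ (refl , refl) =
    ⊥-elim (separated-irrefl (S (φ i)) (∧-intro {S (φ i)} (∧-proj₁ sep) (∧-proj₂ {S (φ i′)} sep′)))
  ... | refl , refl | inj₂ (refl , refl) | inj₁ (refl , refl) =
    ⊥-elim (separated-irrefl (S (φ i′)) (∧-intro {S (φ i′)} (∧-proj₁ sep′) (∧-proj₂ {S (φ i)} sep)))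

  cut-lemma : count (λ i → S (φ i)) (allFin d) * count (λ i → not (S (φ i))) (allFin d) ≤ count (crossᵇ S) E
  cut-lemma = begin
      count (λ i → S (φ i)) (allFin d) * count (λ i → not (S (φ i))) (allFin d)
        ≡⟨ count-pairs (λ i → S (φ i)) (λ i → not (S (φ i))) (allFin d) (allFin d) ⟨
      length pairs
        ≤⟨ injection-length-≤ pairs crossing edgeOf
             (UniqueP.filter⁺ (T? ∘ separated) (UniqueP.cartesianProduct⁺ (UniqueP.allFin⁺ d) (UniqueP.allFin⁺ d)))
             (λ ma mb e → crossingEdge-injective (ce ma) (ce mb) (sep-of ma) (sep-of mb) e)
             (λ m → ∈-filter⁺ (T? ∘ crossᵇ S ∘ lookup E) (∈-allFin _) (CrossingEdge.crosses (ce m))) ⟩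
      count (crossᵇ S ∘ lookup E) (allFin (length E))
        ≡⟨ count-positions (crossᵇ S) E ⟩
      count (crossᵇ S) E ∎
    where
      open ≤-Reasoning
      pairs = filterᵇ separated (cartesianProduct (allFin d) (allFin d))
      crossing = filterᵇ (crossᵇ S ∘ lookup E) (allFin (length E))
      sep-of : ∀ {ij} → ij ∈ pairs → T (separated ij)
      sep-of m = proj₂ (∈-filter⁻ (T? ∘ separated) {xs = cartesianProduct (allFin d) (allFin d)} m)
      ce : ∀ {ij} → ij ∈ pairs → CrossingEdge (proj₁ ij) (proj₂ ij)
      ce m = crossingEdge _ _ (sep-of m)
      edgeOf : ∀ {ij} → ij ∈ pairs → Fin (length E)
      edgeOf m = CrossingEdge.edge (ce m)

module Covered (d : ℕ) {k : ℕ} (P : Edges k) where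

  covered : Edges k → List (Fin k)
  covered = pairVerts d P

  covered-++ : (A C : Edges k) → covered (A ++ C) ≡ covered A ++ covered C
  covered-++ []            C = refl
  covered-++ ((a , b) ∷ A) C = cong (λ z → a ∷ b ∷ z) (covered-++ A C)

  covered-blocks : {K : Set} (X : K → Edges k) (L : List K) → covered (concat (map X L)) ≡ concat (map (covered ∘ X) L)
  covered-blocks X []      = refl
  covered-blocks X (κ ∷ L) = trans (covered-++ (X κ) (concat (map X L))) (cong (covered (X κ) ++_) (covered-blocks X L))

  length-covered : (A : Edges k) → length (covered A) ≡ length A + length A
  length-covered []      = refl
  length-covered (e ∷ A) = cong suc (trans (cong suc (length-covered A)) (sym (+-suc (length A) (length A))))

  All-covered : {Q : Fin k → Set} (A : Edges k) → All Q (covered A) → All (λ e → Q (proj₁ e) × Q (proj₂ e)) A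
  All-covered []      _               = []
  All-covered (e ∷ A) (qa ∷ qb ∷ qs) = (qa , qb) ∷ All-covered A qs

  covered-pairUp : (xs : List (Fin k)) → covered (pairUp xs) ⊆ xs
  covered-pairUp []          = []
  covered-pairUp (a ∷ [])    = a ∷ʳ []
  covered-pairUp (a ∷ b ∷ r) = refl ∷ (refl ∷ covered-pairUp r)

module Cyclic (n₀ : ℕ) where

  next : ℕ → ℕ
  next x = suc x % suc n₀

  next-< : ∀ {x} → x < n₀ → next x ≡ suc x
  next-< x<n₀ = m<n⇒m%n≡m (s≤s x<n₀)

  next-last : next n₀ ≡ 0
  next-last = n%n≡0 (suc n₀)

  prev : ℕ → ℕ
  prev zero    = n₀
  prev (suc a) = a

  prev-≤ : ∀ a → a ≤ n₀ → prev a ≤ n₀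
  prev-≤ zero    _ = ≤-refl
  prev-≤ (suc a) h = ≤-trans (n≤1+n a) h

  next≤n₀ : ∀ x → next x ≤ n₀
  next≤n₀ x = ≤-pred (m%n<n (suc x) (suc n₀))

  next≢self : 1 ≤ n₀ → ∀ {b} → b ≤ n₀ → b ≢ next b
  next≢self 1≤n₀ {b} b≤n₀ b≡next with m≤n⇒m<n∨m≡n b≤n₀
  ... | inj₁ b<n₀ = 1+n≰n (≤-reflexive (sym (trans b≡next (next-< b<n₀))))
  ... | inj₂ refl = 1+n≰n (≤-trans 1≤n₀ (≤-reflexive (trans b≡next next-last)))

  prev≢self : 1 ≤ n₀ → ∀ a → prev a ≢ a
  prev≢self 1≤n₀ zero    p = 1+n≰n (≤-trans 1≤n₀ (≤-reflexive p))
  prev≢self 1≤n₀ (suc a) ()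

  not-mutually-next : 2 ≤ n₀ → ∀ a b → a ≤ n₀ → b ≤ n₀ → b ≡ next a → a ≡ next b → ⊥
  not-mutually-next 2≤n₀ a b a≤n₀ b≤n₀ b≡ a≡ with m≤n⇒m<n∨m≡n a≤n₀ | m≤n⇒m<n∨m≡n b≤n₀
  ... | inj₁ a<n₀ | inj₁ b<n₀ = 1+n≰n (≤-trans (n≤1+n (suc a)) (≤-reflexive (sym (trans a≡ (trans (next-< b<n₀) (cong suc (trans b≡ (next-< a<n₀))))))))
  ... | inj₁ a<n₀ | inj₂ refl = 1+n≰n (≤-trans 2≤n₀ (≤-reflexive (trans b≡ (trans (next-< a<n₀) (cong suc (trans a≡ next-last))))))
  ... | inj₂ refl | inj₁ b<n₀ = 1+n≰n (≤-trans 2≤n₀ (≤-reflexive (trans a≡ (trans (next-< b<n₀) (cong suc (trans b≡ next-last))))))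
  ... | inj₂ refl | inj₂ refl = 1+n≰n (≤-trans (≤-trans (s≤s z≤n) 2≤n₀) (≤-reflexive (trans b≡ next-last)))

  arc-boundary : ∀ {a b x y} → a ≤ x → x ≤ b → (y < a ⊎ b < y) → y ≤ n₀ → b ≤ n₀ →
                 (y ≡ next x ⊎ x ≡ next y) → (x ≡ b × y ≡ next b) ⊎ (x ≡ a × y ≡ prev a)
  arc-boundary {a} {b} {x} {y} a≤x x≤b out y≤n₀ b≤n₀ (inj₁ y≡) with m≤n⇒m<n∨m≡n (≤-trans x≤b b≤n₀)
  ... | inj₁ x<n₀ with trans y≡ (next-< x<n₀) | out
  ...   | refl | inj₁ y<a = ⊥-elim (<-irrefl refl (≤-trans (s≤s (≤-trans a≤x (n≤1+n x))) y<a))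
  ...   | refl | inj₂ b<y = inj₁ (x≡b , trans (sym (next-< x<n₀)) (cong next x≡b))
    where x≡b = ≤-antisym x≤b (≤-pred b<y)
  arc-boundary {a} {b} {x} {y} a≤x x≤b out y≤n₀ b≤n₀ (inj₁ y≡) | inj₂ refl =
    inj₁ (x≡b , trans y≡ (cong next x≡b))
    where x≡b = ≤-antisym x≤b b≤n₀
  arc-boundary {a} {b} {x} {y} a≤x x≤b out y≤n₀ b≤n₀ (inj₂ x≡) with m≤n⇒m<n∨m≡n y≤n₀
  ... | inj₁ y<n₀ with trans x≡ (next-< y<n₀) | out
  ...   | refl | inj₂ b<y = ⊥-elim (<-irrefl refl (≤-trans b<y (≤-trans (n≤1+n y) x≤b)))
  ...   | refl | inj₁ y<a = inj₂ (sym a≡x , sym (cong prev a≡x))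
    where a≡x = ≤-antisym a≤x y<a
  arc-boundary {a} {b} {x} {y} a≤x x≤b out y≤n₀ b≤n₀ (inj₂ x≡) | inj₂ refl with trans x≡ next-last | a≤x
  ... | refl | z≤n = inj₂ (refl , refl)

  adjacentAt : Fin (suc n₀) → Fin (suc n₀) → Fin (suc n₀) → Bool
  adjacentAt i j k = (k ==ᶠ i ∧ (toℕ j ==ℕ next (toℕ k))) ∨ (k ==ᶠ j ∧ (toℕ i ==ℕ next (toℕ k)))

  consecutive-adjacent : ∀ i j → 1 ≤ consecutive i j → toℕ j ≡ next (toℕ i) ⊎ toℕ i ≡ next (toℕ j)
  consecutive-adjacent i j c with count-witness (adjacentAt i j) (allFin (suc n₀)) c
  ... | k , _ , t with ∨-cases {k ==ᶠ i ∧ (toℕ j ==ℕ next (toℕ k))} t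
  ... | inj₁ t₁ with ==ᶠ-sound {x = k} (∧-proj₁ t₁)
  ... | refl = inj₁ (==ℕ-sound (∧-proj₂ {k ==ᶠ k} t₁))
  consecutive-adjacent i j c | k , _ , t | inj₂ t₂ with ==ᶠ-sound {x = k} (∧-proj₁ t₂)
  ... | refl = inj₂ (==ℕ-sound (∧-proj₂ {k ==ᶠ k} t₂))

  consecutive≤2 : ∀ i j → consecutive i j ≤ 2
  consecutive≤2 i j = begin
      consecutive i j                                              ≤⟨ count-mono (adjacentAt i j) (λ k → (k ==ᶠ i) ∨ (k ==ᶠ j)) _ at-i-or-j ⟩
      count (λ k → (k ==ᶠ i) ∨ (k ==ᶠ j)) (allFin (suc n₀))        ≤⟨ count-∨ (λ k → k ==ᶠ i) (λ k → k ==ᶠ j) (allFin (suc n₀)) ⟩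
      count (λ k → k ==ᶠ i) (allFin (suc n₀)) + count (λ k → k ==ᶠ j) (allFin (suc n₀))
                                                                   ≤⟨ +-mono-≤ (count-self≤1 i) (count-self≤1 j) ⟩
      2                                                            ∎
    where
      open ≤-Reasoning
      at-i-or-j : ∀ {k} → k ∈ allFin (suc n₀) → T (adjacentAt i j k) → T ((k ==ᶠ i) ∨ (k ==ᶠ j))
      at-i-or-j {k} _ t with ∨-cases {k ==ᶠ i ∧ (toℕ j ==ℕ next (toℕ k))} t
      ... | inj₁ t₁ = ∨-inj₁ {k ==ᶠ i} {k ==ᶠ j} (∧-proj₁ {k ==ᶠ i} t₁)
      ... | inj₂ t₂ = ∨-inj₂ {k ==ᶠ i} {k ==ᶠ j} (∧-proj₁ {k ==ᶠ j} t₂)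

  consecutive≤1 : 2 ≤ n₀ → ∀ i j → consecutive i j ≤ 1
  consecutive≤1 2≤n₀ i j with toℕ j ℕ.≟ next (toℕ i)
  ... | yes j-next = ≤-trans (count-mono (adjacentAt i j) (λ k → k ==ᶠ i) _ only-i) (count-self≤1 i)
    where
      only-i : ∀ {k} → k ∈ allFin (suc n₀) → T (adjacentAt i j k) → T (k ==ᶠ i)
      only-i {k} _ t with ∨-cases {k ==ᶠ i ∧ (toℕ j ==ℕ next (toℕ k))} t
      ... | inj₁ t₁ = ∧-proj₁ {k ==ᶠ i} t₁
      ... | inj₂ t₂ with ==ᶠ-sound {x = k} (∧-proj₁ {k ==ᶠ j} t₂)
      ... | refl = ⊥-elim (not-mutually-next 2≤n₀ (toℕ i) (toℕ k) (FinP.toℕ≤pred[n] i) (FinP.toℕ≤pred[n] k)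
                             j-next (==ℕ-sound (∧-proj₂ {k ==ᶠ k} t₂)))
  ... | no ¬j-next = ≤-trans (count-mono (adjacentAt i j) (λ k → k ==ᶠ j) _ only-j) (count-self≤1 j)
    where
      only-j : ∀ {k} → k ∈ allFin (suc n₀) → T (adjacentAt i j k) → T (k ==ᶠ j)
      only-j {k} _ t with ∨-cases {k ==ᶠ i ∧ (toℕ j ==ℕ next (toℕ k))} t
      ... | inj₂ t₂ = ∧-proj₁ {k ==ᶠ j} t₂
      ... | inj₁ t₁ with ==ᶠ-sound {x = k} (∧-proj₁ {k ==ᶠ i} t₁)
      ... | refl = ⊥-elim (¬j-next (==ℕ-sound (∧-proj₂ {k ==ᶠ k} t₁)))

module FullDock {d N : ℕ} (E : Edges N) (simple : IsSimple E) (F : FullDockGraph d N E) where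
  open FullDockGraph F

  inPod-complete : ∀ {n′} {v : Fin n′ ⊎ Fin m} {p} → v ≡ inj₂ p → T (inPodᵇ v p)
  inPod-complete {p = p} refl = ==ᶠ-complete {x = p} refl

  inPod-sound : ∀ {n′} (v : Fin n′ ⊎ Fin m) {p} → T (inPodᵇ v p) → v ≡ inj₂ p
  inPod-sound (inj₂ q) t = cong inj₂ (==ᶠ-sound t)

  _≟place_ : (a b : Fin (suc n₀) ⊎ Fin m) → Dec (a ≡ b)
  _≟place_ = SumP.≡-dec _≟ᶠ_ _≟ᶠ_

  incidentᵇ : Fin N → Fin N × Fin N → Bool
  incidentᵇ v e = (proj₁ e ==ᶠ v) ∨ (proj₂ e ==ᶠ v)

  incident≤deg : ∀ v → count (incidentᵇ v) E ≤ deg E v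
  incident≤deg v = count-∨ (λ e → proj₁ e ==ᶠ v) (λ e → proj₂ e ==ᶠ v) E

  joins-incident : ∀ {e : Fin N × Fin N} {u v w} → Joins e u v → (u ≡ w ⊎ v ≡ w) → T (incidentᵇ w e)
  joins-incident {a , b} (inj₁ (refl , refl)) (inj₁ refl) = ∨-inj₁ (==ᶠ-complete {x = a} refl)
  joins-incident {a , b} (inj₁ (refl , refl)) (inj₂ refl) = ∨-inj₂ {a ==ᶠ b} (==ᶠ-complete {x = b} refl)
  joins-incident {a , b} (inj₂ (refl , refl)) (inj₁ refl) = ∨-inj₂ {a ==ᶠ b} (==ᶠ-complete {x = b} refl)
  joins-incident {a , b} (inj₂ (refl , refl)) (inj₂ refl) = ∨-inj₁ (==ᶠ-complete {x = a} refl)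

  module Pod (p : Fin m) where
    k = podSize p
    P = podE p
    em = emb p

    Outside : Fin N → Set
    Outside v = place v ≢ inj₂ p

    externalᵇ : Fin k → Fin N → Bool
    externalᵇ x v = adjᵇ E (em x) v ∧ not (inPodᵇ (place v) p)

    externalᵇ-complete : ∀ {x v} → Outside v → Adj E (em x) v → T (externalᵇ x v)
    externalᵇ-complete {x} {v} out a = ∧-intro {adjᵇ E (em x) v} a (T-not (λ t → out (inPod-sound _ t)))

    adj-pod⇒adj : ∀ {a b} → Adj P a b → Adj E (em a) (em b)
    adj-pod⇒adj {a} {b} = Equivalence.from (podInternal p a b)

    adj⇒adj-pod : ∀ {a b} → Adj E (em a) (em b) → Adj P a b
    adj⇒adj-pod {a} {b} = Equivalence.to (podInternal p a b)

    external-inA : ∀ x v → Outside v → Adj E (em x) v → InA d P x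
    external-inA x v out a with inAᵇ d P x in eq
    ... | true  = ==ℕ-sound (≡true⇒T eq)
    ... | false = ⊥-elim (count-none (externalᵇ x) (allFin N)
                    (trans (podAttach p x) (cong (λ b → if b then 1 else 0) eq)) (∈-allFin v)
                    (externalᵇ-complete out a))

    external-unique : ∀ x v w → Outside v → Adj E (em x) v → Outside w → Adj E (em x) w → v ≡ w
    external-unique x v w outv av outw aw =
      count≤1-unique _≟ᶠ_ (externalᵇ x) (allFin N) (UniqueP.allFin⁺ N) (∈-allFin v) (∈-allFin w)
        (externalᵇ-complete outv av) (externalᵇ-complete outw aw)
        (≤-trans (≤-reflexive (podAttach p x)) (if-≤1 (inAᵇ d P x)))

    external-exists : ∀ x → InA d P x → Σ (Fin N) λ v → Outside v × Adj E (em x) v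
    external-exists x inA =
      let count≡1 = trans (podAttach p x) (cong (λ b → if b then 1 else 0) (T⇒≡true (==ℕ-complete inA)))
          (v , _ , t) = count-witness (externalᵇ x) (allFin N) (≤-reflexive (sym count≡1))
      in v , (λ e → not-T (∧-proj₂ {adjᵇ E (em x) v} t) (inPod-complete e)) , ∧-proj₁ t

    image-edge : ∀ {e} → e ∈ P → Σ (Fin (length E)) λ g → Joins (lookup E g) (em (proj₁ e)) (em (proj₂ e))
    image-edge m = adj-elim E (adj-pod⇒adj (adj-∈ P m (inj₁ (refl , refl))))

    image-edge-injective : ∀ {a b c d} {e e′ : Fin N × Fin N} → Joins e (em a) (em b) → Joins e′ (em c) (em d) →
                           e ≡ e′ → SameEdge (a , b) (c , d)
    image-edge-injective (inj₁ (refl , refl)) (inj₁ (q₁ , q₂)) refl = inj₁ (emb-inj p q₁ , emb-inj p q₂)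
    image-edge-injective (inj₁ (refl , refl)) (inj₂ (q₁ , q₂)) refl = inj₂ (emb-inj p q₁ , emb-inj p q₂)
    image-edge-injective (inj₂ (refl , refl)) (inj₁ (q₁ , q₂)) refl = inj₂ (emb-inj p q₂ , emb-inj p q₁)
    image-edge-injective (inj₂ (refl , refl)) (inj₂ (q₁ , q₂)) refl = inj₁ (emb-inj p q₂ , emb-inj p q₁)

    -- the edges of P at x; since P has no loops each is listed once
    incident-pod : Fin k → List (Fin k × Fin k)
    incident-pod x = filterᵇ (λ e → proj₁ e ==ᶠ x) P ++ filterᵇ (λ e → proj₂ e ==ᶠ x) P

    incident-pod-∈ : ∀ {x e} → e ∈ incident-pod x → e ∈ P × (proj₁ e ≡ x ⊎ proj₂ e ≡ x)
    incident-pod-∈ {x} m with ∈-++⁻ (filterᵇ (λ e → proj₁ e ==ᶠ x) P) m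
    ... | inj₁ m′ = let (e∈ , t) = ∈-filter⁻ (T? ∘ (λ e → proj₁ e ==ᶠ x)) {xs = P} m′ in e∈ , inj₁ (==ᶠ-sound t)
    ... | inj₂ m′ = let (e∈ , t) = ∈-filter⁻ (T? ∘ (λ e → proj₂ e ==ᶠ x)) {xs = P} m′ in e∈ , inj₂ (==ᶠ-sound t)

    incident-pod-unique : ∀ x → Unique (incident-pod x)
    incident-pod-unique x =
      UniqueP.++⁺ (UniqueP.filter⁺ (T? ∘ (λ e → proj₁ e ==ᶠ x)) uniqueP) (UniqueP.filter⁺ (T? ∘ (λ e → proj₂ e ==ᶠ x)) uniqueP)
        (λ (m₁ , m₂) → let (e∈ , t₁) = ∈-filter⁻ (T? ∘ (λ e → proj₁ e ==ᶠ x)) {xs = P} m₁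
                           (_ , t₂) = ∈-filter⁻ (T? ∘ (λ e → proj₂ e ==ᶠ x)) {xs = P} m₂
                       in All.lookup (IsSimple.noLoops simpleP) e∈ (trans (==ᶠ-sound t₁) (sym (==ᶠ-sound t₂))))
      where simpleP = IsPod.simple (pod p)
            uniqueP = simple-unique P simpleP

    image : ∀ {x e} → e ∈ incident-pod x → Fin N × Fin N
    image m = lookup E (proj₁ (image-edge (proj₁ (incident-pod-∈ m))))

    image-joins : ∀ {x e} (m : e ∈ incident-pod x) → Joins (image m) (em (proj₁ e)) (em (proj₂ e))
    image-joins m = proj₂ (image-edge (proj₁ (incident-pod-∈ m)))

    image-incident : ∀ {x e} (m : e ∈ incident-pod x) → image m ∈ filterᵇ (incidentᵇ (em x)) E
    image-incident {x} m = ∈-filter⁺ (T? ∘ incidentᵇ (em x)) (∈-lookup {xs = E} _)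
      (joins-incident (image-joins m) (Sum.map (cong em) (cong em) (proj₂ (incident-pod-∈ m))))

    deg-pod≤ : ∀ x (zs : List (Fin N × Fin N)) → (∀ {e} (m : e ∈ incident-pod x) → image m ∈ zs) → deg P x ≤ length zs
    deg-pod≤ x zs into = begin
        deg P x                   ≡⟨ length-++ (filterᵇ (λ e → proj₁ e ==ᶠ x) P) ⟨
        length (incident-pod x)   ≤⟨ injection-length-≤ (incident-pod x) zs image (incident-pod-unique x) image-injective into ⟩
        length zs                 ∎
      where
        open ≤-Reasoning
        image-injective : ∀ {a b} (ma : a ∈ incident-pod x) (mb : b ∈ incident-pod x) → image ma ≡ image mb → a ≡ b
        image-injective ma mb eq = simple-entry P (IsPod.simple (pod p)) (proj₁ (incident-pod-∈ ma)) (proj₁ (incident-pod-∈ mb))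
          (image-edge-injective (image-joins ma) (image-joins mb) eq)

    deg-pod≤deg : ∀ x → deg P x ≤ deg E (em x)
    deg-pod≤deg x = ≤-trans (deg-pod≤ x _ image-incident) (incident≤deg (em x))

    -- an A-vertex gains its outside edge on top of its pod edges
    deg-inA< : ∀ x → InA d P x → suc (deg P x) ≤ deg E (em x)
    deg-inA< x inA = begin
        suc (deg P x)                          ≤⟨ s≤s (deg-pod≤ x _ (λ m → ∈-remove _ outer∈ (image-incident m) (inner≢outer m))) ⟩
        suc (length (remove incident outer∈))  ≡⟨ length-remove incident outer∈ ⟩
        count (incidentᵇ (em x)) E             ≤⟨ incident≤deg (em x) ⟩
        deg E (em x)                           ∎
      where
        open ≤-Reasoning
        incident = filterᵇ (incidentᵇ (em x)) E
        neighbour = external-exists x inA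
        v = proj₁ neighbour
        outer = adj-elim E (proj₂ (proj₂ neighbour))
        outer∈ : lookup E (proj₁ outer) ∈ incident
        outer∈ = ∈-filter⁺ (T? ∘ incidentᵇ (em x)) (∈-lookup {xs = E} _) (joins-incident (proj₂ outer) (inj₁ refl))
        inner≢outer : ∀ {e} (m : e ∈ incident-pod x) → image m ≢ lookup E (proj₁ outer)
        inner≢outer {a , b} m eq with joins-other-end (subst (λ z → Joins z (em a) (em b)) eq (image-joins m)) (proj₂ outer)
        ... | inj₁ v≡ = proj₁ (proj₂ neighbour) (trans (cong place v≡) (emb-place p a))
        ... | inj₂ v≡ = proj₁ (proj₂ neighbour) (trans (cong place v≡) (emb-place p b))

    insideᵇ : Fin N → Bool
    insideᵇ v = inPodᵇ (place v) p

    record Leaving (e : Fin N × Fin N) : Set where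
      field
        x     : Fin k
        w     : Fin N
        out   : Outside w
        joins : Joins e (em x) w

    leaving : ∀ {e} → T (crossᵇ insideᵇ e) → Leaving e
    leaving {a , b} t with insideᵇ a in ea | insideᵇ b in eb
    ... | true | false =
      let (x , ex) = emb-onto a p (inPod-sound _ (≡true⇒T ea))
      in record { x = x ; w = b ; out = λ q → subst T eb (inPod-complete q) ; joins = inj₁ (sym ex , refl) }
    ... | false | true =
      let (x , ex) = emb-onto b p (inPod-sound _ (≡true⇒T eb))
      in record { x = x ; w = a ; out = λ q → subst T ea (inPod-complete q) ; joins = inj₂ (refl , sym ex) }

    -- At most |A| edges leave the pod: the pod end of a leaving edge lies in A,
    -- and determines the edge because its outside neighbour is unique and E is simple.
    pod-cut : count (crossᵇ insideᵇ) E ≤ sizeA d P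
    pod-cut = injection-length-≤ leavingEdges inAs podEnd
        (UniqueP.filter⁺ (T? ∘ crossᵇ insideᵇ) (simple-unique E simple)) podEnd-injective podEnd-inA
      where
        leavingEdges = filterᵇ (crossᵇ insideᵇ) E
        inAs = filterᵇ (inAᵇ d P) (allFin k)
        in-E : ∀ {e} → e ∈ leavingEdges → e ∈ E
        in-E m = proj₁ (∈-filter⁻ (T? ∘ crossᵇ insideᵇ) {xs = E} m)
        leaving-of : ∀ {e} → e ∈ leavingEdges → Leaving e
        leaving-of m = leaving (proj₂ (∈-filter⁻ (T? ∘ crossᵇ insideᵇ) {xs = E} m))
        adjacent : ∀ {e} (m : e ∈ leavingEdges) → Adj E (em (Leaving.x (leaving-of m))) (Leaving.w (leaving-of m))
        adjacent m = adj-∈ E (in-E m) (Leaving.joins (leaving-of m))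
        podEnd : ∀ {e} → e ∈ leavingEdges → Fin k
        podEnd m = Leaving.x (leaving-of m)
        podEnd-inA : ∀ {e} (m : e ∈ leavingEdges) → podEnd m ∈ inAs
        podEnd-inA m = ∈-filter⁺ (T? ∘ inAᵇ d P) (∈-allFin _)
          (==ℕ-complete (external-inA _ _ (Leaving.out (leaving-of m)) (adjacent m)))
        podEnd-injective : ∀ {a b} (ma : a ∈ leavingEdges) (mb : b ∈ leavingEdges) → podEnd ma ≡ podEnd mb → a ≡ b
        podEnd-injective ma mb eq with leaving-of ma | leaving-of mb | adjacent ma | adjacent mb | eq
        ... | la | lb | adj-a | adj-b | refl =
          simple-entry E simple (in-E ma) (in-E mb)
            (joins-same (Leaving.joins la) (subst (Joins _ _) (sym w≡w′) (Leaving.joins lb)))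
          where w≡w′ = external-unique _ _ _ (Leaving.out la) adj-a (Leaving.out lb) adj-b

  open Pod using (deg-pod≤deg; deg-inA<)

  -- Every vertex has degree at least d - 1: bay vertices because the bays are
  -- full; pod vertices because pods have minimum degree d - 2 and the vertices of
  -- degree exactly d - 2 receive one more edge.
  minimum-degree : ∀ v → d ≤ deg E v + 1
  minimum-degree v with place v in eq
  ... | inj₁ i = full v i eq
  ... | inj₂ p with emb-onto v p eq
  ... | x , refl with (deg (podE p) x + 2) ℕ.≟ d
  ... | yes inA = begin
          d                        ≡⟨ inA ⟨
          deg (podE p) x + 2       ≡⟨ +-suc (deg (podE p) x) 1 ⟩
          suc (deg (podE p) x) + 1 ≤⟨ +-monoˡ-≤ 1 (deg-inA< p x inA) ⟩
          deg E (emb p x) + 1      ∎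
    where open ≤-Reasoning
  ... | no ¬inA = begin
          d                        ≤⟨ ≤-pred (≤-trans (≤∧≢⇒< (IsPod.minDeg (pod p) x) (¬inA ∘ sym)) (≤-reflexive (+-suc (deg (podE p) x) 1))) ⟩
          deg (podE p) x + 1       ≤⟨ +-monoˡ-≤ 1 (deg-pod≤deg p x) ⟩
          deg E (emb p x) + 1      ∎
    where open ≤-Reasoning

  -- A pod contains either none or all of the branch vertices of an immersion of
  -- K_d: with s ≥ 1 inside and t ≥ 1 outside, the cut lemma gives at least
  -- s · t ≥ s + t - 1 = d - 1 edges leaving the pod, but only |A| ≤ d - 2 leave it.
  module _ (I : ImmersionK d E) (p : Fin m) where
    open ImmersionK I
    open Pod p using (insideᵇ; pod-cut)
    open CutLemma E I insideᵇ using (cut-lemma)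

    pod-none-or-all : (∀ i → place (φ i) ≢ inj₂ p) ⊎ (∀ i → place (φ i) ≡ inj₂ p)
    pod-none-or-all with count (λ i → insideᵇ (φ i)) (allFin d) in s-eq | count (λ i → not (insideᵇ (φ i))) (allFin d) in t-eq
    ... | zero | _ = inj₁ (λ i e → count-none (λ i → insideᵇ (φ i)) (allFin d) s-eq (∈-allFin i) (inPod-complete e))
    ... | suc s | zero = inj₂ (λ i → inPod-sound _ (T-stable (count-none (λ i → not (insideᵇ (φ i))) (allFin d) t-eq (∈-allFin i))))
    ... | suc s | suc t = ⊥-elim (1+n≰n (+-cancelˡ-≤ (sizeA d (podE p)) 2 1 (≤-trans (IsPod.fewA (pod p)) d≤|A|+1)))
      where
        open ≤-Reasoning
        d≤|A|+1 : d ≤ sizeA d (podE p) + 1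
        d≤|A|+1 = begin
          d                   ≡⟨ trans (sym (length-tabulate (λ i → i))) (sym (count-compl (λ i → insideᵇ (φ i)) (allFin d))) ⟩
          count (λ i → insideᵇ (φ i)) (allFin d) + count (λ i → not (insideᵇ (φ i))) (allFin d)
                              ≡⟨ cong₂ _+_ s-eq t-eq ⟩
          suc s + suc t       ≤⟨ sum≤product+1 s t ⟩
          suc s * suc t + 1   ≤⟨ +-monoˡ-≤ 1 (≤-trans (subst₂ (λ a b → a * b ≤ _) s-eq t-eq cut-lemma) pod-cut) ⟩
          sizeA d (podE p) + 1 ∎

  -- Every excursion of the walk out of the pod leaves through an edge at an
  -- A-vertex a and returns through an edge at an A-vertex b; it is replaced by a
  -- new edge (a , b).  The walk thereby becomes a walk in the pod graph plus the
  -- list X of new edges, visiting (the copies of) a sublist of its vertices.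

  module Contraction (p : Fin m) where
    open Pod p using (k; P; em; Outside; adj⇒adj-pod)
    open Covered d P using (covered)

    record ExitAt (a : Fin k) {u v : Fin N} (w : Walk E u v) : Set where
      constructor exitAt
      field
        edge    : Fin (length E)
        onWalk  : edge ∈ walkEdges w
        far     : Fin N
        farOut  : Outside far
        joins   : Joins (lookup E edge) (em a) far

    data Traced (G : Edges k) (posP : Fin (length P) → Fin (length G)) {u v : Fin N} (w : Walk E u v)
                (X : Edges k) (posX : Fin (length X) → Fin (length G)) (g : Fin (length G)) : Set where
      viaPod : (c : Fin (length P)) → g ≡ posP c → (f : Fin (length E)) → f ∈ walkEdges w →
               SameEdge (lookup E f) (em (proj₁ (lookup P c)) , em (proj₂ (lookup P c))) → Traced G posP w X posX g
      viaNew : (z : Fin (length X)) → g ≡ posX z → Traced G posP w X posX g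

    Rebuilds : ∀ {u v} (w : Walk E u v) (x y : Fin k) (X : Edges k) → Set
    Rebuilds w x y X =
      (G : Edges k) (posP : Fin (length P) → Fin (length G)) → (∀ c → lookup G (posP c) ≡ lookup P c) →
      (posX : Fin (length X) → Fin (length G)) → (∀ z → lookup G (posX z) ≡ lookup X z) →
      Σ (Walk G x y) λ w′ → map em (walkVerts w′) ⊆ walkVerts w × All (Traced G posP w X posX) (walkEdges w′)

    record FromInside {u v} (w : Walk E u v) (x y : Fin k) : Set where
      field
        X        : Edges k
        exits    : All (λ a → ExitAt a w) (covered X)
        sublist  : map em (covered X) ⊆ walkVerts w
        rebuilds : Rebuilds w x y X

    record FromOutside {z v} (r : Walk E z v) (y : Fin k) : Set where
      field
        b        : Fin k
        X        : Edges k
        entry    : ExitAt b r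
        exits    : All (λ a → ExitAt a r) (covered X)
        sublist  : map em (b ∷ covered X) ⊆ walkVerts r
        rebuilds : Rebuilds r b y X

    exitAt-step : ∀ {a u w v} {e : Fin (length E)} {j : Joins (lookup E e) u w} {r : Walk E w v} →
                  ExitAt a r → ExitAt a (step e j r)
    exitAt-step (exitAt g m z out jz) = exitAt g (there m) z out jz

    traced-step : ∀ {u w v} {e : Fin (length E)} {j : Joins (lookup E e) u w} {r : Walk E w v} {X G posP posX g} →
                  Traced G posP r X posX g → Traced G posP (step e j r) X posX g
    traced-step (viaPod c eq f m same) = viaPod c eq f (there m) same
    traced-step (viaNew z eq)          = viaNew z eq

    traced-cons : ∀ {u v} {w : Walk E u v} {X G posP} {posX : Fin (suc (length X)) → Fin (length G)} {x g} →
                  Traced G posP w X (posX ∘ Fin.suc) g → Traced G posP w (x ∷ X) posX g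
    traced-cons (viaPod c eq f m same) = viaPod c eq f m same
    traced-cons (viaNew z eq)          = viaNew (Fin.suc z) eq

    pod-step : ∀ {a b} → Adj E (em a) (em b) → Σ (Fin (length P)) λ c → Joins (lookup P c) a b
    pod-step adj = adj-elim P (adj⇒adj-pod adj)

    same-copy : ∀ {eE : Fin N × Fin N} {eP : Fin k × Fin k} {a b} → Joins eE (em a) (em b) → Joins eP a b →
                SameEdge eE (em (proj₁ eP) , em (proj₂ eP))
    same-copy (inj₁ (refl , refl)) (inj₁ (refl , refl)) = inj₁ (refl , refl)
    same-copy (inj₁ (refl , refl)) (inj₂ (refl , refl)) = inj₂ (refl , refl)
    same-copy (inj₂ (refl , refl)) (inj₁ (refl , refl)) = inj₂ (refl , refl)
    same-copy (inj₂ (refl , refl)) (inj₂ (refl , refl)) = inj₁ (refl , refl)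

    joins-at : ∀ {e : Fin N × Fin N} {u w a b} → Joins e u w → em a ≡ u → em b ≡ w → Joins e (em a) (em b)
    joins-at j refl refl = j

    joins-at₁ : ∀ {e : Fin N × Fin N} {u w a} → Joins e u w → em a ≡ u → Joins e (em a) w
    joins-at₁ j refl = j

    joins-in : ∀ (G : Edges k) {g : Fin (length G)} {e : Fin k × Fin k} {a b} → lookup G g ≡ e → Joins e a b → Joins (lookup G g) a b
    joins-in G eq j = subst (λ z → Joins z _ _) (sym eq) j

    mutual
      from-inside : ∀ {u v} (w : Walk E u v) x (ux : em x ≡ u) y (vy : em y ≡ v) → FromInside w x y
      from-inside [] x ux y vy with emb-inj p (trans ux (sym vy))
      ... | refl = record { X = [] ; exits = [] ; sublist = _ ∷ʳ []
                          ; rebuilds = λ G posP okP posX okX → [] , ux ∷ [] , [] }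
      from-inside {u} (step {w = u₁} e j rest) x ux y vy with place u₁ ≟place inj₂ p
      ... | yes u₁-in =
        let (x₁ , e₁) = emb-onto u₁ p u₁-in
            (c , jc) = pod-step (adj-intro E e (joins-at j ux e₁))
            module R = FromInside (from-inside rest x₁ e₁ y vy)
        in record
          { X = R.X ; exits = All.map exitAt-step R.exits ; sublist = u ∷ʳ R.sublist
          ; rebuilds = λ G posP okP posX okX → let (w′ , vs , ts) = R.rebuilds G posP okP posX okX in
              step (posP c) (joins-in G {posP c} (okP c) jc) w′ , ux ∷ vs ,
              viaPod c refl e (here refl) (same-copy (joins-at j ux e₁) jc) ∷ All.map traced-step ts }
      ... | no u₁-out =
        let module O = FromOutside (from-outside rest u₁-out y vy)
        in record
          { X = (x , O.b) ∷ O.X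
          ; exits = exitAt e (here refl) u₁ u₁-out (joins-at₁ j ux) ∷ exitAt-step O.entry ∷ All.map exitAt-step O.exits
          ; sublist = ux ∷ O.sublist
          ; rebuilds = λ G posP okP posX okX →
              let (w′ , vs , ts) = O.rebuilds G posP okP (posX ∘ Fin.suc) (okX ∘ Fin.suc) in
              step (posX Fin.zero) (joins-in G {posX Fin.zero} (okX Fin.zero) (inj₁ (refl , refl))) w′ , ux ∷ vs ,
              viaNew Fin.zero refl ∷ All.map (traced-cons ∘ traced-step) ts }

      from-outside : ∀ {z v} (r : Walk E z v) (z-out : Outside z) y (vy : em y ≡ v) → FromOutside r y
      from-outside [] z-out y vy = ⊥-elim (z-out (trans (cong place (sym vy)) (emb-place p y)))
      from-outside {z} (step {w = z₂} e j r₂) z-out y vy with place z₂ ≟place inj₂ p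
      ... | no z₂-out =
        let module O = FromOutside (from-outside r₂ z₂-out y vy)
        in record { b = O.b ; X = O.X ; entry = exitAt-step O.entry ; exits = All.map exitAt-step O.exits
                  ; sublist = z ∷ʳ O.sublist
                  ; rebuilds = λ G posP okP posX okX → let (w′ , vs , ts) = O.rebuilds G posP okP posX okX in
                      w′ , z ∷ʳ vs , All.map traced-step ts }
      ... | yes z₂-in = on-entry e j r₂ z-out y vy z₂-in

      -- the walk enters the pod at z₂ = em b; if it leaves again at once, b is skipped
      on-entry : ∀ {z z₂ v} (e : Fin (length E)) (j : Joins (lookup E e) z z₂) (r₂ : Walk E z₂ v)
                 (z-out : Outside z) y (vy : em y ≡ v) → place z₂ ≡ inj₂ p → FromOutside (step e j r₂) y
      on-entry {z} {z₂} e j [] z-out y vy z₂-in with emb-onto z₂ p z₂-in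
      ... | b , eb with emb-inj p (trans eb (sym vy))
      ... | refl = record { b = b ; X = [] ; entry = exitAt e (here refl) z z-out (joins-at₁ (joins-sym j) eb) ; exits = []
                          ; sublist = z ∷ʳ (eb ∷ [])
                          ; rebuilds = λ G posP okP posX okX → [] , z ∷ʳ (eb ∷ []) , [] }
      on-entry {z} {z₂} e j (step {w = z₃} e′ j′ r₃) z-out y vy z₂-in with place z₃ ≟place inj₂ p
      ... | no z₃-out =
        let module O = FromOutside (from-outside r₃ z₃-out y vy)
        in record { b = O.b ; X = O.X ; entry = exitAt-step (exitAt-step O.entry)
                  ; exits = All.map (exitAt-step ∘ exitAt-step) O.exits
                  ; sublist = z ∷ʳ (z₂ ∷ʳ O.sublist)
                  ; rebuilds = λ G posP okP posX okX → let (w′ , vs , ts) = O.rebuilds G posP okP posX okX in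
                      w′ , z ∷ʳ (z₂ ∷ʳ vs) , All.map (traced-step ∘ traced-step) ts }
      ... | yes z₃-in =
        let (b , eb) = emb-onto z₂ p z₂-in
            (x₃ , e₃) = emb-onto z₃ p z₃-in
            (c , jc) = pod-step (adj-intro E e′ (joins-at j′ eb e₃))
            module R = FromInside (from-inside r₃ x₃ e₃ y vy)
        in record
          { b = b ; X = R.X
          ; entry = exitAt e (here refl) z z-out (joins-at₁ (joins-sym j) eb)
          ; exits = All.map (exitAt-step ∘ exitAt-step) R.exits
          ; sublist = z ∷ʳ (eb ∷ R.sublist)
          ; rebuilds = λ G posP okP posX okX → let (w′ , vs , ts) = R.rebuilds G posP okP posX okX in
              step (posP c) (joins-in G {posP c} (okP c) jc) w′ , z ∷ʳ (eb ∷ vs) ,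
              viaPod c refl e′ (there (here refl)) (same-copy (joins-at j′ eb e₃) jc) ∷ All.map (traced-step ∘ traced-step) ts }

  -- If all branch vertices of an immersion of K_d lie in the pod p, contracting
  -- every route onto the pod gives an immersion of K_d in P ++ M, where M collects
  -- the new edges of all routes and pairs up the remaining A-vertices.  The new
  -- edges of one route are disjoint pairs of A-vertices because the route is a
  -- path, and those of different routes because routes are edge-disjoint and
  -- each A-vertex has a single outside edge; so M is a maximum matching on A,
  -- contradicting that the pod is a d-pod.

  module AllInPod (p : Fin m) (I : ImmersionK d E) (all-in : ∀ i → place (ImmersionK.φ I i) ≡ inj₂ p) where
    open ImmersionK I
    open Pod p using (k; P; em; external-inA; external-unique)
    open Contraction p
    open Covered d P
    open import Data.List.Membership.DecPropositional (_≟ᶠ_ {k}) using (_∈?_)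

    φ′ : Fin d → Fin k
    φ′ i = proj₁ (emb-onto (φ i) p (all-in i))

    em-φ′ : ∀ i → em (φ′ i) ≡ φ i
    em-φ′ i = proj₂ (emb-onto (φ i) p (all-in i))

    Key : Set
    Key = Σ (Fin d × Fin d) (λ ij → proj₁ ij Fin.< proj₂ ij)

    key-≢ : ∀ {i j i′ j′ : Fin d} {lt : i Fin.< j} {lt′ : i′ Fin.< j′} →
            ((i , j) , lt) ≢ ((i′ , j′) , lt′) → i ≢ i′ ⊎ j ≢ j′
    key-≢ {i} {j} {i′} {j′} {lt} {lt′} ne with i ≟ᶠ i′ | j ≟ᶠ j′
    ... | yes refl | yes refl = ⊥-elim (ne (cong (_ ,_) (FinP.<-irrelevant lt lt′)))
    ... | no i≢i′  | _        = inj₁ i≢i′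
    ... | yes _    | no j≢j′  = inj₂ j≢j′

    keyOf : Fin d × Fin d → List Key
    keyOf (i , j) with i FinP.<? j
    ... | yes lt = ((i , j) , lt) ∷ []
    ... | no _   = []

    keyOf-∈ : ∀ {ij κ} → κ ∈ keyOf ij → proj₁ κ ≡ ij
    keyOf-∈ {i , j} m with i FinP.<? j
    keyOf-∈ {i , j} (here refl) | yes lt = refl

    keyOf-unique : ∀ ij → Unique (keyOf ij)
    keyOf-unique (i , j) with i FinP.<? j
    ... | yes lt = [] ∷ []
    ... | no _   = []

    keys : List Key
    keys = concat (map keyOf (cartesianProduct (allFin d) (allFin d)))

    key∈keys : ∀ i j (lt : i Fin.< j) → ((i , j) , lt) ∈ keys
    key∈keys i j lt = ∈-blocks⁺ keyOf _ (∈-cartesianProduct⁺ (∈-allFin i) (∈-allFin j)) key∈keyOf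
      where key∈keyOf : ((i , j) , lt) ∈ keyOf (i , j)
            key∈keyOf with i FinP.<? j
            ... | yes lt′ = here (cong ((i , j) ,_) (FinP.<-irrelevant lt lt′))
            ... | no ¬lt  = ⊥-elim (¬lt lt)

    keys-unique : Unique keys
    keys-unique = unique-blocks keyOf _ (UniqueP.cartesianProduct⁺ (UniqueP.allFin⁺ d) (UniqueP.allFin⁺ d))
      (λ {ij} _ → keyOf-unique ij) (λ _ _ ne m₁ m₂ → ne (trans (sym (keyOf-∈ m₁)) (keyOf-∈ m₂)))

    routeOf : (κ : Key) → Walk E (φ (proj₁ (proj₁ κ))) (φ (proj₂ (proj₁ κ)))
    routeOf ((i , j) , lt) = route i j lt

    contracted : (κ : Key) → FromInside (routeOf κ) (φ′ (proj₁ (proj₁ κ))) (φ′ (proj₂ (proj₁ κ)))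
    contracted ((i , j) , lt) = from-inside (route i j lt) (φ′ i) (em-φ′ i) (φ′ j) (em-φ′ j)

    new : Key → Edges k
    new κ = FromInside.X (contracted κ)

    M₀ : Edges k
    M₀ = concat (map new keys)

    V : List (Fin k)
    V = covered M₀

    uncovered : List (Fin k)
    uncovered = filterᵇ (λ a → inAᵇ d P a ∧ not ⌊ a ∈? V ⌋) (allFin k)

    M : Edges k
    M = M₀ ++ pairUp uncovered

    G : Edges k
    G = P ++ M

    posP : Fin (length P) → Fin (length G)
    posP = injˡ P M

    open Blocks new using (injBlock; lookup-injBlock; injBlock-key)

    posX : ∀ {κ} → κ ∈ keys → Fin (length (new κ)) → Fin (length G)
    posX mκ z = injʳ P M (injˡ M₀ (pairUp uncovered) (injBlock keys mκ z))

    posX-ok : ∀ {κ} (mκ : κ ∈ keys) z → lookup G (posX mκ z) ≡ lookup (new κ) z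
    posX-ok mκ z = trans (lookup-injʳ P M _) (trans (lookup-injˡ M₀ (pairUp uncovered) _) (lookup-injBlock keys mκ z))

    rebuilt : ∀ i j (lt : i Fin.< j) →
              Σ (Walk G (φ′ i) (φ′ j)) λ w′ → map em (walkVerts w′) ⊆ walkVerts (route i j lt) ×
                All (Traced G posP (route i j lt) (new ((i , j) , lt)) (posX (key∈keys i j lt))) (walkEdges w′)
    rebuilt i j lt = FromInside.rebuilds (contracted ((i , j) , lt)) G posP (lookup-injˡ P M)
                       (posX (key∈keys i j lt)) (posX-ok (key∈keys i j lt))

    -- distinct routes are rebuilt with distinct edges: copies of pod edges come from
    -- distinct edges of E, new edges from distinct blocks of M₀
    rebuilt-disjoint : ∀ i j (lt : i Fin.< j) i′ j′ (lt′ : i′ Fin.< j′) → (i ≢ i′ ⊎ j ≢ j′) →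
                       ∀ g → g ∈ walkEdges (proj₁ (rebuilt i j lt)) → g ∈ walkEdges (proj₁ (rebuilt i′ j′ lt′)) → ⊥
    rebuilt-disjoint i j lt i′ j′ lt′ ne g m₁ m₂ =
      both (All.lookup (proj₂ (proj₂ (rebuilt i j lt))) m₁) (All.lookup (proj₂ (proj₂ (rebuilt i′ j′ lt′))) m₂)
      where
        both : Traced G posP (route i j lt) (new ((i , j) , lt)) (posX (key∈keys i j lt)) g →
               Traced G posP (route i′ j′ lt′) (new ((i′ , j′) , lt′)) (posX (key∈keys i′ j′ lt′)) g → ⊥
        both (viaPod c₁ eq₁ f₁ fm₁ same₁) (viaPod c₂ eq₂ f₂ fm₂ same₂) with injˡ-injective P M (trans (sym eq₁) eq₂)
        ... | refl with simple-position E simple f₁ f₂ (sameEdge-trans same₁ (sameEdge-sym same₂))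
        ... | refl = disjoint i j lt i′ j′ lt′ ne f₁ fm₁ fm₂
        both (viaPod c₁ eq₁ _ _ _) (viaNew z₂ eq₂) = injˡ≢injʳ P M (trans (sym eq₁) eq₂)
        both (viaNew z₁ eq₁) (viaPod c₂ eq₂ _ _ _) = injˡ≢injʳ P M (trans (sym eq₂) eq₁)
        both (viaNew z₁ eq₁) (viaNew z₂ eq₂)
          with injBlock-key keys (key∈keys i j lt) (key∈keys i′ j′ lt′)
                 (injˡ-injective M₀ (pairUp uncovered) (injʳ-injective P M (trans (sym eq₁) eq₂)))
        ... | refl = [ (λ n → n refl) , (λ n → n refl) ]′ ne

    -- the contracted routes form an immersion of K_d in P ++ M; they are paths
    -- because their vertices form a sublist of a path
    immersion : ImmersionK d G
    immersion = record
      { φ        = φ′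
      ; φ-inj    = λ {i} {j} e → φ-inj (trans (sym (em-φ′ i)) (trans (cong em e) (em-φ′ j)))
      ; route    = λ i j lt → proj₁ (rebuilt i j lt)
      ; isPath   = λ i j lt → UniqueP.map⁻ (unique-⊆ (proj₁ (proj₂ (rebuilt i j lt))) (isPath i j lt))
      ; disjoint = rebuilt-disjoint }

    exit-of : ∀ κ {a} → a ∈ covered (new κ) → ExitAt a (routeOf κ)
    exit-of ((i , j) , lt) m = All.lookup (FromInside.exits (contracted ((i , j) , lt))) m

    exit-inA : ∀ {a u v} {w : Walk E u v} → ExitAt a w → InA d P a
    exit-inA (exitAt g _ z out jz) = external-inA _ z out (adj-intro E g jz)

    covered-inA : ∀ {a} → a ∈ V → InA d P a
    covered-inA m =
      let (κ , _ , ma) = ∈-blocks⁻ (covered ∘ new) keys (subst (_ ∈_) (covered-blocks new keys) m)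
      in exit-inA (exit-of κ ma)

    -- the new edges of one route cover distinct vertices: they form a sublist of a path
    block-unique : ∀ κ → Unique (covered (new κ))
    block-unique ((i , j) , lt) =
      UniqueP.map⁻ (unique-⊆ (FromInside.sublist (contracted ((i , j) , lt))) (isPath i j lt))

    -- different routes cover different vertices: a shared vertex would share its outside edge
    blocks-disjoint : ∀ {κ κ′ a} → κ ≢ κ′ → a ∈ covered (new κ) → a ∈ covered (new κ′) → ⊥
    blocks-disjoint {((i , j) , lt)} {((i′ , j′) , lt′)} {a} ne ma ma′ =
      shared (exit-of ((i , j) , lt) ma) (exit-of ((i′ , j′) , lt′) ma′)
      where
        shared : ExitAt a (route i j lt) → ExitAt a (route i′ j′ lt′) → ⊥
        shared (exitAt g₁ gm₁ z₁ out₁ jz₁) (exitAt g₂ gm₂ z₂ out₂ jz₂)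
          with external-unique a z₁ z₂ out₁ (adj-intro E g₁ jz₁) out₂ (adj-intro E g₂ jz₂)
        ... | refl with simple-position E simple g₁ g₂ (joins-same jz₁ jz₂)
        ... | refl = disjoint i j lt i′ j′ lt′ (key-≢ ne) g₁ gm₁ gm₂

    V-unique : Unique V
    V-unique = subst Unique (sym (covered-blocks new keys))
      (unique-blocks (covered ∘ new) keys keys-unique (λ {κ} _ → block-unique κ) (λ _ _ → blocks-disjoint))

    uncovered-∈ : ∀ {a} → a ∈ uncovered → InA d P a × ¬ a ∈ V
    uncovered-∈ {a} m =
      let (_ , t) = ∈-filter⁻ (T? ∘ (λ a → inAᵇ d P a ∧ not ⌊ a ∈? V ⌋)) {xs = allFin k} m
      in ==ℕ-sound (∧-proj₁ t) , (λ a∈V → not-T (∧-proj₂ {inAᵇ d P a} t) (fromWitness a∈V))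

    paired-∈ : ∀ {a} → a ∈ covered (pairUp uncovered) → InA d P a × ¬ a ∈ V
    paired-∈ m = uncovered-∈ (Any-resp-⊆ (covered-pairUp uncovered) m)

    covered-count : count (λ a → inAᵇ d P a ∧ ⌊ a ∈? V ⌋) (allFin k) ≡ length V
    covered-count = ≤-antisym
      (⊆-length-≤ (filterᵇ inV (allFin k)) V (UniqueP.filter⁺ (T? ∘ inV) (UniqueP.allFin⁺ k))
         (λ {a} m → toWitness (∧-proj₂ {inAᵇ d P a} (proj₂ (∈-filter⁻ (T? ∘ inV) {xs = allFin k} m)))))
      (⊆-length-≤ V (filterᵇ inV (allFin k)) V-unique
         (λ {a} m → ∈-filter⁺ (T? ∘ inV) (∈-allFin a) (∧-intro {inAᵇ d P a} (==ℕ-complete (covered-inA m)) (fromWitness m))))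
      where inV = λ a → inAᵇ d P a ∧ ⌊ a ∈? V ⌋

    size-M : length M ≡ sizeA d P / 2
    size-M = begin
        length M                                         ≡⟨ length-++ M₀ ⟩
        length M₀ + length (pairUp uncovered)            ≡⟨ cong (length M₀ +_) (length-pairUp uncovered) ⟩
        length M₀ + length uncovered / 2                 ≡⟨ half-double+ (length M₀) (length uncovered) ⟨
        (length M₀ + length M₀ + length uncovered) / 2   ≡⟨ cong (λ z → (z + length uncovered) / 2) (length-covered M₀) ⟨
        (length V + length uncovered) / 2                ≡⟨ cong (λ z → (z + length uncovered) / 2) covered-count ⟨
        (count (λ a → inAᵇ d P a ∧ ⌊ a ∈? V ⌋) (allFin k) + length uncovered) / 2
                                                         ≡⟨ cong (_/ 2) (count-split (inAᵇ d P) (λ a → ⌊ a ∈? V ⌋) (allFin k)) ⟨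
        sizeA d P / 2                                    ∎
      where open ≡-Reasoning

    matching : IsMaxMatchingOnA d P M
    matching = record
      { inA      = All-covered M (subst (All (InA d P)) (sym (covered-++ M₀ (pairUp uncovered)))
                     (AllP.++⁺ (All.tabulate covered-inA) (All.tabulate (proj₁ ∘ paired-∈))))
      ; disjoint = subst Unique (sym (covered-++ M₀ (pairUp uncovered)))
                     (UniqueP.++⁺ V-unique (unique-⊆ (covered-pairUp uncovered) (UniqueP.filter⁺ _ (UniqueP.allFin⁺ k)))
                       (λ (m₁ , m₂) → proj₂ (paired-∈ m₂) m₁))
      ; size     = size-M }

  not-all-in-pod : (I : ImmersionK d E) (p : Fin m) → ¬ (∀ i → place (ImmersionK.φ I i) ≡ inj₂ p)
  not-all-in-pod I p all-in = IsPod.noImmers (pod p) M matching immersion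
    where open AllInPod p I all-in

  open Cyclic n₀

  Bay : Set
  Bay = Fin (suc n₀)

  inBay-complete : ∀ {n′} {v : Bay ⊎ Fin n′} {i} → v ≡ inj₁ i → T (inBayᵇ v i)
  inBay-complete {i = i} refl = ==ᶠ-complete {x = i} refl

  betweenᵇ : Bay → Bay → Fin N × Fin N → Bool
  betweenᵇ i j e = (inBayᵇ (place (proj₁ e)) i ∧ inBayᵇ (place (proj₂ e)) j)
                 ∨ (inBayᵇ (place (proj₁ e)) j ∧ inBayᵇ (place (proj₂ e)) i)

  between-intro : ∀ {e : Fin N × Fin N} {i j} → place (proj₁ e) ≡ inj₁ i → place (proj₂ e) ≡ inj₁ j → T (betweenᵇ i j e)
  between-intro {e} {i} {j} p₁ p₂ =
    ∨-inj₁ {inBayᵇ (place (proj₁ e)) i ∧ inBayᵇ (place (proj₂ e)) j} (∧-intro {inBayᵇ (place (proj₁ e)) i} (inBay-complete p₁) (inBay-complete p₂))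

  between-sym : ∀ {e : Fin N × Fin N} {i j} → T (betweenᵇ i j e) → T (betweenᵇ j i e)
  between-sym {e} {i} {j} t with ∨-cases {inBayᵇ (place (proj₁ e)) i ∧ inBayᵇ (place (proj₂ e)) j} t
  ... | inj₁ t₁ = ∨-inj₂ {inBayᵇ (place (proj₁ e)) j ∧ inBayᵇ (place (proj₂ e)) i} t₁
  ... | inj₂ t₂ = ∨-inj₁ {inBayᵇ (place (proj₁ e)) j ∧ inBayᵇ (place (proj₂ e)) i} t₂

  between-adjacent : ∀ i j → i ≢ j → ∀ {e} → e ∈ E → T (betweenᵇ i j e) → 1 ≤ consecutive i j
  between-adjacent i j i≢j m t with consecutive i j in c
  ... | suc _ = s≤s z≤n
  ... | zero = ⊥-elim (1+n≰n (begin
        1                                        ≤⟨ count-pos (betweenᵇ i j) E m t ⟩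
        count (betweenᵇ i j) E                   ≤⟨ m≤m+n _ _ ⟩
        count (betweenᵇ i j) E + 3 * consecutive i j ≤⟨ betweenBays i j i≢j ⟩
        d * consecutive i j                      ≡⟨ trans (cong (d *_) c) (*-zeroʳ d) ⟩
        0                                        ∎))
    where open ≤-Reasoning

  between-≤ : 3 ≤ d → 2 ≤ n₀ → ∀ i j → i ≢ j → count (betweenᵇ i j) E + 3 ≤ d
  between-≤ 3≤d 2≤n₀ i j i≢j = between-bound₁ d (consecutive i j) _ (betweenBays i j i≢j) (consecutive≤1 2≤n₀ i j) 3≤d

  between-≤₂ : 3 ≤ d → ∀ i j → i ≢ j → count (betweenᵇ i j) E + 6 ≤ d + d
  between-≤₂ 3≤d i j i≢j = between-bound₂ d (consecutive i j) _ (betweenBays i j i≢j) (consecutive≤2 i j) 3≤d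

  -- The unit of a set B of bays: the vertices of the bays in B together with
  -- the pods added to them.  Its crossing edges all join two bays.
  unitOf : (Bay → Bool) → Bay ⊎ Fin m → Bool
  unitOf B (inj₁ i) = B i
  unitOf B (inj₂ p) = B (host p)

  unitᵇ : (Bay → Bool) → Fin N → Bool
  unitᵇ B v = unitOf B (place v)

  pod-same-unit : ∀ B {a c} p → place a ≡ inj₂ p → Adj E a c → unitᵇ B a ≡ unitᵇ B c
  pod-same-unit B {a} {c} p pa adj with emb-onto a p pa
  ... | x , refl with place c ≟place inj₂ p
  ...   | yes pc = trans (cong (unitOf B) pa) (sym (cong (unitOf B) pc))
  ...   | no ¬pc = trans (cong (unitOf B) pa) (sym (cong (unitOf B) (podExternal p x c ¬pc adj)))

  record BayEdge (B : Bay → Bool) (e : Fin N × Fin N) : Set where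
    field
      b₁ b₂ : Bay
      at₁   : place (proj₁ e) ≡ inj₁ b₁
      at₂   : place (proj₂ e) ≡ inj₁ b₂
      cross : T (B b₁ xor B b₂)

  -- an edge crossing a unit joins two bays, since a pod and its neighbours share a unit
  crossing-bays : ∀ B {e} → e ∈ E → T (crossᵇ (unitᵇ B) e) → BayEdge B e
  crossing-bays B {a , c} m t with place a in pa | place c in pc
  ... | inj₁ i | inj₁ j = record { b₁ = i ; b₂ = j ; at₁ = pa ; at₂ = pc ; cross = t }
  ... | inj₂ p | _      = ⊥-elim (xor-self (unitᵇ B c)
                            (subst (λ z → T (z xor unitᵇ B c)) (pod-same-unit B p pa (adj-∈ E m (inj₁ (refl , refl))))
                              (subst₂ (λ u v → T (unitOf B u xor unitOf B v)) (sym pa) (sym pc) t)))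
  ... | inj₁ i | inj₂ p = ⊥-elim (xor-self (unitᵇ B a)
                            (subst (λ z → T (z xor unitᵇ B a)) (pod-same-unit B p pc (adj-∈ E m (inj₂ (refl , refl))))
                              (xor-sym (unitᵇ B a) (unitᵇ B c) (subst₂ (λ u v → T (unitOf B u xor unitOf B v)) (sym pa) (sym pc) t))))

  record Outward (B : Bay → Bool) (e : Fin N × Fin N) : Set where
    field
      x y     : Bay
      x∈B     : T (B x)
      y∉B     : ¬ T (B y)
      between : T (betweenᵇ x y e)

  outward : ∀ B {e} → BayEdge B e → Outward B e
  outward B {e} be with B (BayEdge.b₁ be) in eq₁ | B (BayEdge.b₂ be) in eq₂ | BayEdge.cross be
  ... | true  | false | _ = record { x = BayEdge.b₁ be ; y = BayEdge.b₂ be ; x∈B = ≡true⇒T eq₁ ; y∉B = subst T eq₂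
                                   ; between = between-intro (BayEdge.at₁ be) (BayEdge.at₂ be) }
  ... | false | true  | _ = record { x = BayEdge.b₂ be ; y = BayEdge.b₁ be ; x∈B = ≡true⇒T eq₂ ; y∉B = subst T eq₁
                                   ; between = between-sym (between-intro (BayEdge.at₁ be) (BayEdge.at₂ be)) }

  outward-≢ : ∀ {B e} (o : Outward B e) → Outward.x o ≢ Outward.y o
  outward-≢ {B} o x≡y = Outward.y∉B o (subst (T ∘ B) x≡y (Outward.x∈B o))

  Arc : (Bay → Bool) → ℕ → ℕ → Set
  Arc B a b = ∀ k → (T (B k) → a ≤ toℕ k × toℕ k ≤ b) × (a ≤ toℕ k → toℕ k ≤ b → T (B k))

  arc-outside : ∀ {B a b} → Arc B a b → ∀ k → ¬ T (B k) → toℕ k < a ⊎ b < toℕ k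
  arc-outside {B} {a} {b} arc k k∉B with toℕ k ℕ.<? a | b ℕ.<? toℕ k
  ... | yes k<a | _      = inj₁ k<a
  ... | no _    | yes b<k = inj₂ b<k
  ... | no k≮a  | no b≮k = ⊥-elim (k∉B (proj₂ (arc k) (≮⇒≥ k≮a) (≮⇒≥ b≮k)))

  bay-at : ∀ {x} → x ≤ n₀ → Bay
  bay-at x≤n₀ = fromℕ< (s≤s x≤n₀)

  bay-at-toℕ : ∀ {x} (x≤n₀ : x ≤ n₀) (k : Bay) → toℕ k ≡ x → k ≡ bay-at x≤n₀
  bay-at-toℕ x≤n₀ k eq = FinP.toℕ-injective (trans eq (sym (FinP.toℕ-fromℕ< (s≤s x≤n₀))))

  bay-at-injective : ∀ {x y} (x≤n₀ : x ≤ n₀) (y≤n₀ : y ≤ n₀) → bay-at x≤n₀ ≡ bay-at y≤n₀ → x ≡ y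
  bay-at-injective x≤n₀ y≤n₀ eq =
    trans (sym (FinP.toℕ-fromℕ< (s≤s x≤n₀))) (trans (cong toℕ eq) (FinP.toℕ-fromℕ< (s≤s y≤n₀)))

  arc-exit : ∀ B a b (a≤b : a ≤ b) (b≤n₀ : b ≤ n₀) → Arc B a b → ∀ {e} → e ∈ E → T (crossᵇ (unitᵇ B) e) →
             T (betweenᵇ (bay-at b≤n₀) (bay-at (next≤n₀ b)) e ∨ betweenᵇ (bay-at (prev-≤ a (≤-trans a≤b b≤n₀))) (bay-at (≤-trans a≤b b≤n₀)) e)
  arc-exit B a b a≤b b≤n₀ arc {e} m t with outward B (crossing-bays B m t)
  ... | o with proj₁ (arc (Outward.x o)) (Outward.x∈B o)
  ... | a≤x , x≤b
    with arc-boundary a≤x x≤b (arc-outside arc (Outward.y o) (Outward.y∉B o)) (FinP.toℕ≤pred[n] (Outward.y o)) b≤n₀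
           (consecutive-adjacent (Outward.x o) (Outward.y o) (between-adjacent _ _ (outward-≢ o) m (Outward.between o)))
  ... | inj₁ (x≡b , y≡next) =
    ∨-inj₁ {betweenᵇ (bay-at b≤n₀) (bay-at (next≤n₀ b)) e} (subst₂ (λ u v → T (betweenᵇ u v e))
      (bay-at-toℕ b≤n₀ _ x≡b) (bay-at-toℕ (next≤n₀ b) _ y≡next) (Outward.between o))
  ... | inj₂ (x≡a , y≡prev) =
    ∨-inj₂ {betweenᵇ (bay-at b≤n₀) (bay-at (next≤n₀ b)) e} (between-sym (subst₂ (λ u v → T (betweenᵇ u v e))
      (bay-at-toℕ (≤-trans a≤b b≤n₀) _ x≡a) (bay-at-toℕ (prev-≤ a (≤-trans a≤b b≤n₀)) _ y≡prev) (Outward.between o)))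

  -- With at least three bays, the edges leaving the unit of an arc run along its
  -- two boundary pairs, each carrying at most d - 3 edges.
  arc-cut-cycle : 3 ≤ d → 2 ≤ n₀ → ∀ B a b → a ≤ b → b ≤ n₀ → Arc B a b → count (crossᵇ (unitᵇ B)) E + 6 ≤ d + d
  arc-cut-cycle 3≤d 2≤n₀ B a b a≤b b≤n₀ arc = begin
      count (crossᵇ (unitᵇ B)) E + 6
        ≤⟨ +-monoˡ-≤ 6 (≤-trans (count-mono _ _ E (arc-exit B a b a≤b b≤n₀ arc)) (count-∨ (betweenᵇ last after) (betweenᵇ before first) E)) ⟩
      count (betweenᵇ last after) E + count (betweenᵇ before first) E + 6
        ≡⟨ regroup (count (betweenᵇ last after) E) (count (betweenᵇ before first) E) ⟩
      (count (betweenᵇ last after) E + 3) + (count (betweenᵇ before first) E + 3)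
        ≤⟨ +-mono-≤ (between-≤ 3≤d 2≤n₀ last after (next≢self 1≤n₀ b≤n₀ ∘ bay-at-injective b≤n₀ (next≤n₀ b)))
                    (between-≤ 3≤d 2≤n₀ before first (prev≢self 1≤n₀ a ∘ bay-at-injective (prev-≤ a a≤n₀) a≤n₀)) ⟩
      d + d ∎
    where
      open ≤-Reasoning
      regroup : ∀ x y → x + y + 6 ≡ (x + 3) + (y + 3)
      regroup = solve-∀
      1≤n₀ = ≤-trans (s≤s z≤n) 2≤n₀
      a≤n₀ = ≤-trans a≤b b≤n₀
      last after first before : Bay
      last   = bay-at b≤n₀
      after  = bay-at (next≤n₀ b)
      first  = bay-at a≤n₀
      before = bay-at (prev-≤ a a≤n₀)

  -- With two bays every crossing edge joins them, so there are at most 2(d - 3).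
  cut-two-bays : 3 ≤ d → n₀ ≡ 1 → ∀ B → count (crossᵇ (unitᵇ B)) E + 6 ≤ d + d
  cut-two-bays 3≤d refl B = ≤-trans (+-monoˡ-≤ 6 (count-mono _ (betweenᵇ Fin.zero (Fin.suc Fin.zero)) E joins-both))
                              (between-≤₂ 3≤d Fin.zero (Fin.suc Fin.zero) (λ ()))
    where
      joins-both : ∀ {e} → e ∈ E → T (crossᵇ (unitᵇ B) e) → T (betweenᵇ Fin.zero (Fin.suc Fin.zero) e)
      joins-both m t with outward B (crossing-bays B m t)
      ... | o with Outward.x o | Outward.y o | outward-≢ o | Outward.between o
      ... | Fin.zero          | Fin.zero          | x≢y | _ = ⊥-elim (x≢y refl)
      ... | Fin.zero          | Fin.suc Fin.zero  | _   | bt = bt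
      ... | Fin.suc Fin.zero  | Fin.zero          | _   | bt = between-sym bt
      ... | Fin.suc Fin.zero  | Fin.suc Fin.zero  | x≢y | _ = ⊥-elim (x≢y refl)

  cut-one-bay : n₀ ≡ 0 → ∀ B → count (crossᵇ (unitᵇ B)) E ≡ 0
  cut-one-bay refl B = count-zero _ E (λ m t → outward-≢ (outward B (crossing-bays B m t)) (one _ _))
    where one : (x y : Fin 1) → x ≡ y
          one Fin.zero Fin.zero = refl

  arc-cut : 3 ≤ d → ∀ B a b → a ≤ b → b ≤ n₀ → Arc B a b → count (crossᵇ (unitᵇ B)) E + 6 ≤ d + d
  arc-cut 3≤d B a b a≤b b≤n₀ arc with 2 ℕ.≤? n₀ | n₀ ℕ.≟ 1
  ... | yes 2≤n₀ | _      = arc-cut-cycle 3≤d 2≤n₀ B a b a≤b b≤n₀ arc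
  ... | no _     | yes n₀≡1 = cut-two-bays 3≤d n₀≡1 B
  ... | no 2≰n₀  | no n₀≢1 = ≤-trans (≤-reflexive (cong (_+ 6) (cut-one-bay n₀≡0 B))) (+-mono-≤ 3≤d 3≤d)
    where n₀≡0 : n₀ ≡ 0
          n₀≡0 = n≤0⇒n≡0 (≤-pred (≤∧≢⇒< (≤-pred (≰⇒> 2≰n₀)) n₀≢1))

  -- Suppose now that every branch vertex of an immersion of K_d lies in a bay.
  -- Let s of them lie in the unit of an arc and t = d - s outside it.  If s ≥ 2
  -- and t ≥ 2, or s = 2, then s t ≥ 2(s + t) - 4 = 2d - 4 edges would have to
  -- leave the unit, more than 2(d - 3).  Such an arc always exists: a single bay
  -- holding at least two branch vertices (it holds at most d - 2), or else,
  -- when every bay holds at most one, the shortest initial arc holding two.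

  module BranchInBays (I : ImmersionK d E) (in-bays : ∀ i p → place (ImmersionK.φ I i) ≢ inj₂ p) where
    open ImmersionK I

    bay-of : ∀ i → Σ Bay λ b → place (φ i) ≡ inj₁ b
    bay-of i with place (φ i) in eq
    ... | inj₁ b = b , refl
    ... | inj₂ p = ⊥-elim (in-bays i p eq)

    bayOf : Fin d → Bay
    bayOf i = proj₁ (bay-of i)

    inside# outside# : (Bay → Bool) → ℕ
    inside#  B = count (λ i → B (bayOf i)) (allFin d)
    outside# B = count (λ i → not (B (bayOf i))) (allFin d)

    inside+outside : ∀ B → inside# B + outside# B ≡ d
    inside+outside B = trans (count-compl (λ i → B (bayOf i)) (allFin d)) (length-tabulate (λ i → i))

    unit-cut : ∀ B → inside# B * outside# B ≤ count (crossᵇ (unitᵇ B)) E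
    unit-cut B = subst₂ (λ s t → s * t ≤ _)
      (count-ext _ _ (allFin d) (λ i → in-unit i))
      (count-ext _ _ (allFin d) (λ i → cong not (in-unit i)))
      (CutLemma.cut-lemma E I (unitᵇ B))
      where in-unit : ∀ i → unitᵇ B (φ i) ≡ B (bayOf i)
            in-unit i = cong (unitOf B) (proj₂ (bay-of i))

    balanced-arc : 3 ≤ d → ∀ B a b → a ≤ b → b ≤ n₀ → Arc B a b →
                   2 ≤ inside# B → (2 ≤ outside# B ⊎ inside# B ≡ 2) → ⊥
    balanced-arc 3≤d B a b a≤b b≤n₀ arc 2≤s t-cond = 6≰4 (+-cancelˡ-≤ (s * t) 6 4 (begin
        s * t + 6                     ≤⟨ +-monoˡ-≤ 6 (unit-cut B) ⟩
        count (crossᵇ (unitᵇ B)) E + 6 ≤⟨ arc-cut 3≤d B a b a≤b b≤n₀ arc ⟩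
        d + d                         ≡⟨ cong (λ z → z + z) (inside+outside B) ⟨
        (s + t) + (s + t)             ≡⟨ cong ((s + t) +_) (+-identityʳ (s + t)) ⟨
        2 * (s + t)                   ≤⟨ double-sum≤product+4 s t 2≤s t-cond ⟩
        s * t + 4                     ∎))
      where
        open ≤-Reasoning
        s = inside# B
        t = outside# B
        6≰4 : ¬ 6 ≤ 4
        6≰4 (s≤s (s≤s (s≤s (s≤s ()))))

    inBay# below# : ℕ → ℕ
    inBay# K = count (λ i → toℕ (bayOf i) ==ℕ K) (allFin d)
    below# K = count (λ i → toℕ (bayOf i) <ᵇ K) (allFin d)

    inBay#-bound : ∀ (k : Bay) → inBay# (toℕ k) + 2 ≤ d
    inBay#-bound k = ≤-trans (+-monoˡ-≤ 2 (injection-length-≤ _ _ (λ {i} _ → φ i)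
        (UniqueP.filter⁺ (T? ∘ (λ i → toℕ (bayOf i) ==ℕ toℕ k)) (UniqueP.allFin⁺ d))
        (λ _ _ e → φ-inj e) in-bay-k)) (baySize k)
      where
        in-bay-k : ∀ {i} → i ∈ filterᵇ (λ i → toℕ (bayOf i) ==ℕ toℕ k) (allFin d) →
                   φ i ∈ filterᵇ (λ v → inBayᵇ (place v) k) (allFin N)
        in-bay-k {i} m = ∈-filter⁺ (T? ∘ (λ v → inBayᵇ (place v) k)) (∈-allFin (φ i))
          (inBay-complete (trans (proj₂ (bay-of i)) (cong inj₁ (FinP.toℕ-injective
             (==ℕ-sound (proj₂ (∈-filter⁻ (T? ∘ (λ i → toℕ (bayOf i) ==ℕ toℕ k)) {xs = allFin d} m)))))))

    below#-zero : below# 0 ≡ 0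
    below#-zero = count-zero _ (allFin d) (λ {i} _ t → n≮0 (<ᵇ⇒< (toℕ (bayOf i)) 0 t))

    below#-all : below# (suc n₀) ≡ d
    below#-all = trans (count-full _ (allFin d) (λ {i} _ → <⇒<ᵇ (FinP.toℕ<n (bayOf i)))) (length-tabulate (λ i → i))

    below#-suc : ∀ K → below# (suc K) ≡ below# K + inBay# K
    below#-suc K = trans (count-split (λ i → toℕ (bayOf i) <ᵇ suc K) (λ i → toℕ (bayOf i) <ᵇ K) (allFin d))
      (cong₂ _+_ (count-ext _ _ (allFin d) (λ i → below-below (toℕ (bayOf i))))
                 (count-ext _ _ (allFin d) (λ i → below-not-below (toℕ (bayOf i)))))
      where
        below-below : ∀ x → ((x <ᵇ suc K) ∧ (x <ᵇ K)) ≡ (x <ᵇ K)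
        below-below x = T-ext (∧-proj₂ {x <ᵇ suc K})
          (λ t → ∧-intro {x <ᵇ suc K} (<⇒<ᵇ (≤-trans (<ᵇ⇒< x K t) (n≤1+n K))) t)
        below-not-below : ∀ x → ((x <ᵇ suc K) ∧ not (x <ᵇ K)) ≡ (x ==ℕ K)
        below-not-below x = T-ext
          (λ t → ==ℕ-complete (≤-antisym (≤-pred (<ᵇ⇒< x (suc K) (∧-proj₁ {x <ᵇ suc K} t)))
                                        (≮⇒≥ (λ x<K → not-T (∧-proj₂ {x <ᵇ suc K} t) (<⇒<ᵇ x<K)))))
          (λ t → let x≡K = ==ℕ-sound t in
                 ∧-intro {x <ᵇ suc K} (<⇒<ᵇ (s≤s (≤-reflexive x≡K))) (T-not (λ x<K → <-irrefl x≡K (<ᵇ⇒< x K x<K))))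

    single-bay-arc : ∀ K → Arc (λ k → toℕ k ==ℕ K) K K
    single-bay-arc K k = (λ t → let e = ==ℕ-sound t in ≤-reflexive (sym e) , ≤-reflexive e) ,
                         (λ K≤k k≤K → ==ℕ-complete (≤-antisym k≤K K≤k))

    initial-arc : ∀ b → Arc (λ k → toℕ k <ᵇ suc b) 0 b
    initial-arc b k = (λ t → z≤n , ≤-pred (<ᵇ⇒< (toℕ k) (suc b) t)) , (λ _ k≤b → <⇒<ᵇ (s≤s k≤b))

    crowded-bay : 3 ≤ d → ∀ (k : Bay) → 2 ≤ inBay# (toℕ k) → ⊥
    crowded-bay 3≤d k 2≤c = balanced-arc 3≤d B (toℕ k) (toℕ k) ≤-refl (FinP.toℕ≤pred[n] k) (single-bay-arc (toℕ k)) 2≤c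
      (inj₁ (+-cancelˡ-≤ (inBay# (toℕ k)) 2 _ (≤-trans (inBay#-bound k) (≤-reflexive (sym (inside+outside B))))))
      where B = λ (b : Bay) → toℕ b ==ℕ toℕ k

    sparse-bays : 3 ≤ d → (∀ (k : Bay) → inBay# (toℕ k) ≤ 1) → ⊥
    sparse-bays 3≤d sparse with intermediate-value below# below#-zero (suc n₀) unit-steps 2 (≤-trans (≤-trans (n≤1+n 2) 3≤d) (≤-reflexive (sym below#-all)))
      where
        unit-steps : ∀ K → K < suc n₀ → below# (suc K) ≤ suc (below# K)
        unit-steps K K<n = ≤-trans (≤-reflexive (below#-suc K))
          (≤-trans (+-monoʳ-≤ (below# K) (subst (λ z → inBay# z ≤ 1) (FinP.toℕ-fromℕ< K<n) (sparse (fromℕ< K<n))))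
                   (≤-reflexive (+-comm (below# K) 1)))
    ... | zero  , _ , below≡2 = 1+n≰n (≤-trans (≤-reflexive (sym (trans (sym below#-zero) below≡2))) z≤n)
    ... | suc b , b<n , below≡2 =
      balanced-arc 3≤d (λ k → toℕ k <ᵇ suc b) 0 b z≤n (≤-pred b<n) (initial-arc b) (≤-reflexive (sym below≡2)) (inj₂ below≡2)

    -- the bay of a branch vertex leaves room for d - 2 ≥ 1 vertices, so d ≥ 3
    three≤d : 1 ≤ d → 3 ≤ d
    three≤d 1≤d = ≤-trans (+-monoˡ-≤ 2 (count-pos _ (allFin d) (∈-allFin i₀) (==ℕ-complete {x = toℕ (bayOf i₀)} refl)))
                          (inBay#-bound (bayOf i₀))
      where i₀ = fromℕ< 1≤d

    no-branch-in-bays : 1 ≤ d → ⊥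
    no-branch-in-bays 1≤d with FinP.any? (λ (k : Bay) → 2 ℕ.≤? inBay# (toℕ k))
    ... | yes (k , 2≤c) = crowded-bay (three≤d 1≤d) k 2≤c
    ... | no none = sparse-bays (three≤d 1≤d) (λ k → ≤-pred (≰⇒> (λ 2≤c → none (k , 2≤c))))

theorem3p6 : (d : ℕ) → 1 ≤ d → (N : ℕ) (E : Edges N) → IsSimple E →
    FullDockGraph d N E →
    ((v : Fin N) → d ≤ deg E v + 1) × ¬ ImmersionK d E
theorem3p6 d 1≤d N E simple F = minimum-degree , no-immersion
  where
    open FullDockGraph F using (place)
    open FullDock E simple F using (minimum-degree; pod-none-or-all; not-all-in-pod; module BranchInBays)

    no-immersion : ¬ ImmersionK d E
    no-immersion I = BranchInBays.no-branch-in-bays I in-bays 1≤d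
      where
        in-bays : ∀ i p → place (ImmersionK.φ I i) ≢ inj₂ p
        in-bays i p with pod-none-or-all I p
        ... | inj₁ none = none i
        ... | inj₂ all  = ⊥-elim (not-all-in-pod I p all)
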